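{- Let $t,u$ be ordinary $\lambda$-terms with $t\sqsubseteq_{\mathcal{B}\eta_{\mathrm{red}}}u$, and suppose $\Gamma\vdash^kt^\bullet:L$ is derivable. Then $\Gamma'\vdash^{k'}u^\bullet:L'$ is derivable for some $\Gamma',L',k'$ with $(\Gamma',L')\le^+_p(\Gamma,L)$, where $0\le p=k-k'$.
   Context: $\sqsubseteq_{\mathcal{B}\eta_{\mathrm{red}}}$ on ordinary $\lambda$-terms is the largest relation such that $t\sqsubseteq_{\mathcal{B}\eta_{\mathrm{red}}}u$ implies either $t$ has no head normal form, or $t$ has head normal form $\lambda x_1\ldots x_{n+p}.y\,t_1\cdots t_{k+p}$ and $u$ has head normal form $\lambda x_1\ldots x_n.y\,u_1\cdots u_k$ with $p\ge0$, $y$ equally bound or free in both, $t_i\sqsubseteq u_i$ ($i\le k$), $t_i\sqsubseteq x_i$ ($k<i\le k+p$), and $x_{k+1},\ldots,x_{k+p}$ not free in $y\,u_1\cdots u_k$. Checkers terms: $t ::= x\mid\lambda_cx.t\mid t\cdot^cu$, $c\in\{\circ,\bullet\}$. Black painting: $x^\bullet=x$, $(\lambda x.t)^\bullet=\lambda_\bullet x.t^\bullet$, $(tu)^\bullet=t^\bullet\cdot^\bullet u^\bullet$. Types: linear $L ::= X\mid M\to_cL$; multi $M ::= [L_1,\ldots,L_n]$; environments $\Gamma$ (finite support), pointwise $+$, $\Gamma,x:M$ with $x\notin\mathrm{supp}(\Gamma)$. Rules: (ax) $x:[L]\vdash^0x:L$; (many) from $\Gamma_i\vdash^{k_i}t:L_i$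 ($i\in I$ finite) infer $\sum\Gamma_i\vdash^{\sum k_i}t:[L_i]_{i\in I}$; ($\lambda$) from $\Gamma,x:M\vdash^kt:L$ infer $\Gamma\vdash^k\lambda_cx.t:M\to_cL$; (@) from $\Gamma\vdash^{k_1}t:M\to_cL$ and $\Delta\vdash^{k_2}u:M$ infer $\Gamma+\Delta\vdash^kt\cdot^du:L$, $k=k_1+k_2$ if $c=d$, else $k_1+k_2+1$. Polarized whitening $\le^a_k$ ($a\in\{+,-\}$, $\bar a$ opposite), mutual induction: $X\le^a_0X$; if $M'\le^-_{k_1}M$, $L'\le^+_{k_2}L$ then $(M'\to_\circ L')\le^+_{k_1+k_2+1}(M\to_\bullet L)$; for any $c$, if $M'\le^{\bar a}_{k_1}M$, $L'\le^a_{k_2}L$ then $(M'\to_cL')\le^a_{k_1+k_2}(M\to_cL)$; $[L'_i]_{i\le n}\le^a_{\sum k_i}[L_i]_{i\le n}$ when $L'_i\le^a_{k_i}L_i$; no other rules. Environments pointwise with summed indices; pairs $(\Gamma',L')\le^a_{k_1+k_2}(\Gamma,L)$ iff $\Gamma'\le^{\bar a}_{k_1}\Gamma$ and $L'\le^a_{k_2}L$. -}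

module Defs where

open import Data.Nat using (ℕ; zero; suc; _+_; _<ᵇ_; _≡ᵇ_; pred)
open import Data.Bool using (if_then_else_)
open import Data.List using (List; []; _∷_; _++_; map; length)
open import Data.List.Relation.Binary.Pointwise using (Pointwise)
open import Data.Product using (Σ; Σ-syntax; ∃; _×_)
open import Data.Sum using (_⊎_)
open import Relation.Nullary using (¬_)
open import Relation.Binary.PropositionalEquality using (_≡_)
open import Relation.Binary.Construct.Closure.ReflexiveTransitive using (Star)

-- Ordinary λ-terms (de Bruijn indices; var 0 = innermost binder)

data Term : Set where
  var : ℕ → Term
  lam : Term → Term
  app : Term → Term → Term

lift : ℕ → ℕ → Term → Term
lift d c (var x)   = if x <ᵇ c then var x else var (x + d)
lift d c (lam t)   = lam (lift d (suc c) t)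
lift d c (app t u) = app (lift d c t) (lift d c u)

sub : ℕ → Term → Term → Term
sub j s (var x)   = if x ≡ᵇ j then lift j 0 s else (if j <ᵇ x then var (pred x) else var x)
sub j s (lam t)   = lam (sub (suc j) s t)
sub j s (app t u) = app (sub j s t) (sub j s u)

data _⟶β_ : Term → Term → Set where
  beta  : ∀ {t u} → app (lam t) u ⟶β sub 0 u t
  ξlam  : ∀ {t t'} → t ⟶β t' → lam t ⟶β lam t'
  ξappl : ∀ {t t' u} → t ⟶β t' → app t u ⟶β app t' u
  ξappr : ∀ {t u u'} → u ⟶β u' → app t u ⟶β app t u'

_↠β_ : Term → Term → Set
_↠β_ = Star _⟶β_

lams : ℕ → Term → Term
lams zero    t = t
lams (suc n) t = lam (lams n t)

apps : Term → List Term → Term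
apps t []       = t
apps t (u ∷ us) = apps (app t u) us

HasHNF : Term → Set
HasHNF t = Σ[ n ∈ ℕ ] Σ[ y ∈ ℕ ] Σ[ ts ∈ List Term ] (t ↠β lams n (apps (var y) ts))

-- the variables x_{n+1} … x_{n+p} of the p innermost binders, in order
etaVars : ℕ → List Term
etaVars zero    = []
etaVars (suc p) = var p ∷ etaVars p

-- The defining clause of ⊑_{Bη_red}, relative to a relation R.
-- t ↠ λx₁…x_{n+p}. y t₁…t_k t_{k+1}…t_{k+p},  u ↠ λx₁…xₙ. y u₁…u_k.
-- In t the head variable has index y+p when it has index y in u
-- (i.e. it is the same bound x_j, j ≤ n, or the same free variable).
-- u_i is weakened by p (so x_{n+1..n+p} are not free in it) to live in t_i's scope.
BClause : (Term → Term → Set) → Term → Term → Set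
BClause R t u =
  (¬ HasHNF t) ⊎
  (Σ[ n ∈ ℕ ] Σ[ p ∈ ℕ ] Σ[ y ∈ ℕ ] Σ[ ts ∈ List Term ] Σ[ ex ∈ List Term ] Σ[ us ∈ List Term ]
     ( (t ↠β lams (n + p) (apps (var (y + p)) (ts ++ ex)))
     × (u ↠β lams n (apps (var y) us))
     × Pointwise R ts (map (lift p 0) us)
     × Pointwise R ex (etaVars p)))

-- R is a post-fixed point of the clause
IsBSim : (Term → Term → Set) → Set
IsBSim R = ∀ {t u} → R t u → BClause R t u

-- the largest such relation (union of all post-fixed points)
_⊑Bη_ : Term → Term → Set₁
t ⊑Bη u = Σ[ R ∈ (Term → Term → Set) ] (IsBSim R × R t u)

data Col : Set where
  white black : Col

data CTerm : Set where
  cvar : ℕ → CTerm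
  clam : Col → CTerm → CTerm
  capp : Col → CTerm → CTerm → CTerm

paint : Term → CTerm
paint (var x)   = cvar x
paint (lam t)   = clam black (paint t)
paint (app t u) = capp black (paint t) (paint u)

-- Types: multisets represented by lists, environments by lists of
-- multisets indexed by de Bruijn index (beyond the length: empty).

data LTy : Set where
  atom : ℕ → LTy
  arr  : List LTy → Col → LTy → LTy

MTy : Set
MTy = List LTy

Env : Set
Env = List MTy

hd : Env → MTy
hd []      = []
hd (M ∷ _) = M

tl : Env → Env
tl []      = []
tl (_ ∷ Γ) = Γ

_+E_ : Env → Env → Env
[]      +E Δ       = Δ
(M ∷ Γ) +E []      = M ∷ Γ
(M ∷ Γ) +E (N ∷ Δ) = (M ++ N) ∷ (Γ +E Δ)

single : ℕ → LTy → Env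
single zero    L = (L ∷ []) ∷ []
single (suc x) L = [] ∷ single x L

-- equality of types as (nested) multisets, and of environments
mutual
  data _≈L_ : LTy → LTy → Set where
    atom : ∀ {X} → atom X ≈L atom X
    arr  : ∀ {M M' c L L'} → M ≈M M' → L ≈L L' → arr M c L ≈L arr M' c L'

  data _≈M_ : MTy → MTy → Set where
    []  : [] ≈M []
    ins : ∀ {L L' M M₁ M₂} → L ≈L L' → M ≈M (M₁ ++ M₂) → (L ∷ M) ≈M (M₁ ++ L' ∷ M₂)

data _≈E_ : Env → Env → Set where
  []   : [] ≈E []
  step : ∀ {Γ Δ} → hd Γ ≈M hd Δ → tl Γ ≈E tl Δ → Γ ≈E Δ

cost : Col → Col → ℕ
cost white white = 0
cost black black = 0
cost white black = 1
cost black white = 1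

-- typing judgements  Γ ⊢^k t : L   and   Γ ⊢^k t : M
-- (environments/multisets are taken up to ≈ in the conclusions)
mutual
  data _⊢[_]_∶_ : Env → ℕ → CTerm → LTy → Set where
    ax  : ∀ {Γ x L} → Γ ≈E single x L → Γ ⊢[ 0 ] cvar x ∶ L
    lam : ∀ {Γ M k t c L} → (M ∷ Γ) ⊢[ k ] t ∶ L → Γ ⊢[ k ] clam c t ∶ arr M c L
    app : ∀ {Γ Γ₁ Γ₂ k₁ k₂ t u c d M M' L} →
          Γ₁ ⊢[ k₁ ] t ∶ arr M c L → Γ₂ ⊢[ k₂ ] u ∶M M' → M ≈M M' → Γ ≈E (Γ₁ +E Γ₂) →
          Γ ⊢[ k₁ + k₂ + cost c d ] capp d t u ∶ L

  data _⊢[_]_∶M_ : Env → ℕ → CTerm → MTy → Set where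
    []  : ∀ {t} → [] ⊢[ 0 ] t ∶M []
    _∷_ : ∀ {Γ₁ Γ₂ k₁ k₂ t L M} → Γ₁ ⊢[ k₁ ] t ∶ L → Γ₂ ⊢[ k₂ ] t ∶M M →
          (Γ₁ +E Γ₂) ⊢[ k₁ + k₂ ] t ∶M (L ∷ M)

data Pol : Set where
  pos neg : Pol

opp : Pol → Pol
opp pos = neg
opp neg = pos

mutual
  data Wh : Pol → ℕ → LTy → LTy → Set where
    atom  : ∀ {a X} → Wh a 0 (atom X) (atom X)
    whiten : ∀ {k₁ k₂ M' M L' L} → WhM neg k₁ M' M → Wh pos k₂ L' L →
             Wh pos (k₁ + k₂ + 1) (arr M' white L') (arr M black L)
    same  : ∀ {a c k₁ k₂ M' M L' L} → WhM (opp a) k₁ M' M → Wh a k₂ L' L →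
            Wh a (k₁ + k₂) (arr M' c L') (arr M c L)

  data WhM : Pol → ℕ → MTy → MTy → Set where
    []  : ∀ {a} → WhM a 0 [] []
    ins : ∀ {a k₁ k₂ L' L M' M₁ M₂} → Wh a k₁ L' L → WhM a k₂ M' (M₁ ++ M₂) →
          WhM a (k₁ + k₂) (L' ∷ M') (M₁ ++ L ∷ M₂)

data WhE : Pol → ℕ → Env → Env → Set where
  []   : ∀ {a} → WhE a 0 [] []
  step : ∀ {a k₁ k₂ Γ' Γ} → WhM a k₁ (hd Γ') (hd Γ) → WhE a k₂ (tl Γ') (tl Γ) →
         WhE a (k₁ + k₂) Γ' Γ

WhP : Pol → ℕ → Env → LTy → Env → LTy → Set
WhP a k Γ' L' Γ L =
  Σ[ k₁ ∈ ℕ ] Σ[ k₂ ∈ ℕ ] (k ≡ k₁ + k₂ × WhE (opp a) k₁ Γ' Γ × Wh a k₂ L' L)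

{-# OPTIONS --safe #-}
module Submission where

-- Derivations are measured by their size, the number of their ax, λ and @ rules. Typing is
-- invariant under β in both directions with the same counter, and head reduction strictly decreases
-- the size, so a typable t has a head normal form λx₁…x_{n+p}.y t₁…t_{k+p}, typed by a derivation no
-- larger than the given one. By induction on the size, that derivation yields derivations of the u_i
-- (from t_i ⊑ u_i) and types for the binders x_{n+1}…x_{n+p} (from the η-arguments t_{k+i} ⊑ x_{n+i});
-- together they type λx₁…xₙ.y u₁…u_k, and subject expansion transfers this to u. The counter is
-- conserved except at an η-argument applied through a white arrow of y's type: the 1 that t pays
-- there for the colour mismatch is paid in u's type instead, by whitening the black λ-arrow of t's
-- type to that white arrow.

open import Defs
open import Algebra.Bundles using (CommutativeSemigroup)
import Algebra.Properties.CommutativeSemigroup as CommutativeSemigroupProperties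
open import Data.Bool using (true; false; T)
open import Data.Empty using (⊥-elim)
open import Data.List using (List; []; _∷_; _++_; length; map)
open import Data.List.Properties using (++-assoc; ++-identityʳ; ∷-injective; length-++)
open import Data.List.Relation.Binary.Pointwise using (Pointwise; []; _∷_)
open import Data.Nat using (ℕ; zero; suc; pred; _+_; _<_; _≤_; _≡ᵇ_; _<ᵇ_; z≤n; s≤s; s≤s⁻¹)
open import Data.Nat.Properties
  using (+-identityʳ; +-assoc; +-comm; +-suc; suc-injective; +-commutativeSemigroup; +-mono-≤; +-monoˡ-<;
         ≤-trans; ≤-refl; ≤-reflexive; <⇒≤; m≤n⇒m≤1+n; <-≤-trans; ≤-<-trans; m≤m+n; m≤n+m; n≤1+n;
         <-cmp; _<?_; ≮⇒≥; <⇒≢; >⇒≢; <⇒≱; <-asym; <ᵇ⇒<; <⇒<ᵇ; ≡ᵇ⇒≡; ≡⇒≡ᵇ)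
open import Data.Nat.Tactic.RingSolver using (solve-∀)
open import Data.Product using (Σ-syntax; _×_; _,_)
open import Data.Sum using (_⊎_; inj₁; inj₂)
open import Data.Unit using (⊤; tt)
open import Relation.Binary.Construct.Closure.ReflexiveTransitive using (ε; _◅_)
open import Relation.Binary.Definitions using (tri<; tri≈; tri>)
open import Relation.Binary.PropositionalEquality
  using (_≡_; _≢_; refl; sym; trans; cong; cong₂; subst; subst₂; module ≡-Reasoning)
open import Relation.Nullary using (yes; no)

open CommutativeSemigroupProperties +-commutativeSemigroup using (interchange; x∙yz≈y∙xz)


-- Multisets up to permutation

++-∷-split : ∀ {A : Set} (M₁ M₂ Q₁ Q₂ : List A) x → M₁ ++ M₂ ≡ Q₁ ++ x ∷ Q₂ →
  (Σ[ Z ∈ List A ] (M₁ ≡ Q₁ ++ x ∷ Z × Q₂ ≡ Z ++ M₂)) ⊎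
  (Σ[ W ∈ List A ] (M₂ ≡ W ++ x ∷ Q₂ × Q₁ ≡ M₁ ++ W))
++-∷-split []       M₂ Q₁       Q₂ x eq   = inj₂ (Q₁ , eq , refl)
++-∷-split (a ∷ M₁) M₂ []       Q₂ x refl = inj₁ (M₁ , refl , refl)
++-∷-split (a ∷ M₁) M₂ (b ∷ Q₁) Q₂ x eq with ∷-injective eq
... | refl , eq′ with ++-∷-split M₁ M₂ Q₁ Q₂ x eq′
...   | inj₁ (Z , refl , refl) = inj₁ (Z , refl , refl)
...   | inj₂ (W , refl , refl) = inj₂ (W , refl , refl)

mutual
  ≈L-refl : ∀ L → L ≈L L
  ≈L-refl (atom x)    = atom
  ≈L-refl (arr M c L) = arr (≈M-refl M) (≈L-refl L)

  ≈M-refl : ∀ M → M ≈M M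
  ≈M-refl []      = []
  ≈M-refl (L ∷ M) = ins {M₁ = []} (≈L-refl L) (≈M-refl M)

≡⇒≈M : ∀ {M N} → M ≡ N → M ≈M N
≡⇒≈M {M} refl = ≈M-refl M

insˡ : ∀ M₁ {M₂ L L' Y} → L' ≈L L → (M₁ ++ M₂) ≈M Y → (M₁ ++ L' ∷ M₂) ≈M (L ∷ Y)
insˡ []       l m = ins {M₁ = []} l m
insˡ (a ∷ M₁) l (ins {M₁ = Y₁} a' m) = ins {M₁ = _ ∷ Y₁} a' (insˡ M₁ l m)

mutual
  ≈L-sym : ∀ {L L'} → L ≈L L' → L' ≈L L
  ≈L-sym atom      = atom
  ≈L-sym (arr m l) = arr (≈M-sym m) (≈L-sym l)

  ≈M-sym : ∀ {M N} → M ≈M N → N ≈M M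
  ≈M-sym []                  = []
  ≈M-sym (ins {M₁ = M₁} l m) = insˡ M₁ (≈L-sym l) (≈M-sym m)

≈M-remove : ∀ N₁ {N₂ L P} → (N₁ ++ L ∷ N₂) ≈M P →
  Σ[ P₁ ∈ MTy ] Σ[ P₂ ∈ MTy ] Σ[ L' ∈ LTy ]
    (P ≡ P₁ ++ L' ∷ P₂ × L ≈L L' × (N₁ ++ N₂) ≈M (P₁ ++ P₂))
≈M-remove []       (ins l m) = _ , _ , _ , refl , l , m
≈M-remove (a ∷ N₁) (ins {L' = a'} {M₁ = M₁} {M₂ = M₂} l m) with ≈M-remove N₁ m
... | Q₁ , Q₂ , L' , eq , l' , m' with ++-∷-split M₁ M₂ Q₁ Q₂ L' eq
...   | inj₁ (Z , refl , refl) =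
  Q₁ , Z ++ a' ∷ M₂ , L' , ++-assoc Q₁ (L' ∷ Z) (a' ∷ M₂) , l' ,
  subst (_ ≈M_) (++-assoc Q₁ Z (a' ∷ M₂))
    (ins {M₁ = Q₁ ++ Z} l (subst (_ ≈M_) (sym (++-assoc Q₁ Z M₂)) m'))
...   | inj₂ (W , refl , refl) =
  M₁ ++ a' ∷ W , Q₂ , L' , sym (++-assoc M₁ (a' ∷ W) (L' ∷ Q₂)) , l' ,
  subst (_ ≈M_) (sym (++-assoc M₁ (a' ∷ W) Q₂))
    (ins {M₁ = M₁} l (subst (_ ≈M_) (++-assoc M₁ W Q₂) m'))

mutual
  ≈L-trans : ∀ {A B C} → A ≈L B → B ≈L C → A ≈L C
  ≈L-trans atom      atom        = atom
  ≈L-trans (arr m l) (arr m' l') = arr (≈M-trans m m') (≈L-trans l l')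

  ≈M-trans : ∀ {A B C} → A ≈M B → B ≈M C → A ≈M C
  ≈M-trans [] q = q
  ≈M-trans (ins {M₁ = N₁} l m) q with ≈M-remove N₁ q
  ... | _ , _ , _ , refl , l' , q' = ins (≈L-trans l l') (≈M-trans m q')

≈M-++ : ∀ {A B C D} → A ≈M B → C ≈M D → (A ++ C) ≈M (B ++ D)
≈M-++ [] q = q
≈M-++ {D = D} (ins {M₁ = B₁} {M₂ = B₂} l m) q =
  subst (_ ≈M_) (sym (++-assoc B₁ (_ ∷ B₂) D))
    (ins {M₁ = B₁} {M₂ = B₂ ++ D} l (subst (_ ≈M_) (++-assoc B₁ B₂ D) (≈M-++ m q)))

≈M-++-comm : ∀ A B → (A ++ B) ≈M (B ++ A)
≈M-++-comm []      B = ≡⇒≈M (sym (++-identityʳ B))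
≈M-++-comm (a ∷ A) B = ins {M₁ = B} (≈L-refl a) (≈M-++-comm A B)

≈M-[] : ∀ {M} → M ≈M [] → M ≡ []
≈M-[] m with ≈M-sym m
... | [] = refl



-- Whitening of types

Wh-≡ : ∀ {a k k' A B} → k ≡ k' → Wh a k A B → Wh a k' A B
Wh-≡ refl w = w

WhM-≡ : ∀ {a k k' A B} → k ≡ k' → WhM a k A B → WhM a k' A B
WhM-≡ refl w = w

WhM-remove : ∀ {a k} N₁ {N₂ L P} → WhM a k (N₁ ++ L ∷ N₂) P →
  Σ[ P₁ ∈ MTy ] Σ[ P₂ ∈ MTy ] Σ[ L' ∈ LTy ] Σ[ k₁ ∈ ℕ ] Σ[ k₂ ∈ ℕ ]
    (P ≡ P₁ ++ L' ∷ P₂ × Wh a k₁ L L' × WhM a k₂ (N₁ ++ N₂) (P₁ ++ P₂) × k ≡ k₁ + k₂)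
WhM-remove []       (ins l m) = _ , _ , _ , _ , _ , refl , l , m , refl
WhM-remove (a ∷ N₁) (ins {k₁ = j} {L = a'} {M₁ = M₁} {M₂ = M₂} l m) with WhM-remove N₁ m
... | Q₁ , Q₂ , L' , k₁ , k₂ , eq , l' , m' , refl with ++-∷-split M₁ M₂ Q₁ Q₂ L' eq
...   | inj₁ (Z , refl , refl) =
  Q₁ , Z ++ a' ∷ M₂ , L' , k₁ , j + k₂ , ++-assoc Q₁ (L' ∷ Z) (a' ∷ M₂) , l' ,
  subst (WhM _ _ _) (++-assoc Q₁ Z (a' ∷ M₂))
    (ins {M₁ = Q₁ ++ Z} l (subst (WhM _ _ _) (sym (++-assoc Q₁ Z M₂)) m')) ,
  x∙yz≈y∙xz j k₁ k₂
...   | inj₂ (W , refl , refl) =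
  M₁ ++ a' ∷ W , Q₂ , L' , k₁ , j + k₂ , sym (++-assoc M₁ (a' ∷ W) (L' ∷ Q₂)) , l' ,
  subst (WhM _ _ _) (sym (++-assoc M₁ (a' ∷ W) Q₂))
    (ins {M₁ = M₁} l (subst (WhM _ _ _) (++-assoc M₁ W Q₂) m')) ,
  x∙yz≈y∙xz j k₁ k₂

mutual
  Wh-trans : ∀ {a k₁ k₂ A B C} → Wh a k₁ A B → Wh a k₂ B C → Wh a (k₁ + k₂) A C
  Wh-trans atom atom = atom
  Wh-trans (whiten {k₁ = a} {k₂ = b} m l) (same {k₁ = c} {k₂ = d} m' l') =
    Wh-≡ (e a b c d) (whiten (WhM-trans m m') (Wh-trans l l'))
    where
    e : ∀ a b c d → a + c + (b + d) + 1 ≡ a + b + 1 + (c + d)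
    e = solve-∀
  Wh-trans (same {k₁ = a} {k₂ = b} m l) (whiten {k₁ = c} {k₂ = d} m' l') =
    Wh-≡ (e a b c d) (whiten (WhM-trans m m') (Wh-trans l l'))
    where
    e : ∀ a b c d → a + c + (b + d) + 1 ≡ a + b + (c + d + 1)
    e = solve-∀
  Wh-trans (same {k₁ = a} {k₂ = b} m l) (same {k₁ = c} {k₂ = d} m' l') =
    Wh-≡ (interchange a c b d) (same (WhM-trans m m') (Wh-trans l l'))

  WhM-trans : ∀ {a k₁ k₂ A B C} → WhM a k₁ A B → WhM a k₂ B C → WhM a (k₁ + k₂) A C
  WhM-trans [] [] = []
  WhM-trans (ins {k₁ = a} {k₂ = b} {M₁ = N₁} l m) q with WhM-remove N₁ q
  ... | _ , _ , _ , c , d , refl , l' , q' , refl =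
    WhM-≡ (interchange a c b d) (ins (Wh-trans l l') (WhM-trans m q'))

mutual
  ≈L⇒Wh : ∀ {a L L'} → L ≈L L' → Wh a 0 L L'
  ≈L⇒Wh atom      = atom
  ≈L⇒Wh (arr m l) = same (≈M⇒WhM m) (≈L⇒Wh l)

  ≈M⇒WhM : ∀ {a M M'} → M ≈M M' → WhM a 0 M M'
  ≈M⇒WhM []        = []
  ≈M⇒WhM (ins l m) = ins (≈L⇒Wh l) (≈M⇒WhM m)

Wh-refl : ∀ {a} L → Wh a 0 L L
Wh-refl L = ≈L⇒Wh (≈L-refl L)

WhM-≈ʳ : ∀ {a k A B C} → WhM a k A B → B ≈M C → WhM a k A C
WhM-≈ʳ {k = k} w e = WhM-≡ (+-identityʳ k) (WhM-trans w (≈M⇒WhM e))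

WhM-≈ˡ : ∀ {a k A B C} → A ≈M B → WhM a k B C → WhM a k A C
WhM-≈ˡ e w = WhM-trans (≈M⇒WhM e) w

WhM-++ : ∀ {a k₁ k₂ A B C D} → WhM a k₁ A B → WhM a k₂ C D → WhM a (k₁ + k₂) (A ++ C) (B ++ D)
WhM-++ [] q = q
WhM-++ {D = D} (ins {k₁ = a} {k₂ = b} {M₁ = B₁} {M₂ = B₂} l m) q =
  WhM-≡ (sym (+-assoc a b _)) (subst (WhM _ _ _) (sym (++-assoc B₁ (_ ∷ B₂) D))
    (ins {M₁ = B₁} {M₂ = B₂ ++ D} l (subst (WhM _ _ _) (++-assoc B₁ B₂ D) (WhM-++ m q))))



-- Environments

≈E-refl : ∀ Γ → Γ ≈E Γ
≈E-refl []      = []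
≈E-refl (M ∷ Γ) = step (≈M-refl M) (≈E-refl Γ)

≡⇒≈E : ∀ {Γ Δ} → Γ ≡ Δ → Γ ≈E Δ
≡⇒≈E {Γ} refl = ≈E-refl Γ

≈E-sym : ∀ {Γ Δ} → Γ ≈E Δ → Δ ≈E Γ
≈E-sym []         = []
≈E-sym (step h t) = step (≈M-sym h) (≈E-sym t)

≈E-trans : ∀ {Γ Δ Θ} → Γ ≈E Δ → Δ ≈E Θ → Γ ≈E Θ
≈E-trans []         q             = q
≈E-trans (step h t) []            = step h t
≈E-trans (step h t) (step h' t') = step (≈M-trans h h') (≈E-trans t t')

infixr 5 _▸_
_▸_ : ∀ {Γ Δ Θ} → Γ ≈E Δ → Δ ≈E Θ → Γ ≈E Θ
_▸_ = ≈E-trans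

≈E-hd : ∀ {Γ Δ} → Γ ≈E Δ → hd Γ ≈M hd Δ
≈E-hd []         = []
≈E-hd (step h _) = h

≈E-tl : ∀ {Γ Δ} → Γ ≈E Δ → tl Γ ≈E tl Δ
≈E-tl []         = []
≈E-tl (step _ t) = t

≈E-hd∷tl : ∀ Γ → Γ ≈E (hd Γ ∷ tl Γ)
≈E-hd∷tl []      = step [] []
≈E-hd∷tl (M ∷ Γ) = ≈E-refl (M ∷ Γ)

++-congʳ-≈E : ∀ Rs {Θ Θ'} → Θ ≈E Θ' → (Rs ++ Θ) ≈E (Rs ++ Θ')
++-congʳ-≈E []       p = p
++-congʳ-≈E (R ∷ Rs) p = step (≈M-refl R) (++-congʳ-≈E Rs p)

hd-+E : ∀ Γ Δ → hd (Γ +E Δ) ≡ hd Γ ++ hd Δ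
hd-+E []      Δ       = refl
hd-+E (M ∷ Γ) []      = sym (++-identityʳ M)
hd-+E (M ∷ Γ) (N ∷ Δ) = refl

+E-identityʳ : ∀ Γ → Γ +E [] ≡ Γ
+E-identityʳ []      = refl
+E-identityʳ (M ∷ Γ) = refl

tl-+E : ∀ Γ Δ → tl (Γ +E Δ) ≡ tl Γ +E tl Δ
tl-+E []      Δ       = refl
tl-+E (M ∷ Γ) []      = sym (+E-identityʳ Γ)
tl-+E (M ∷ Γ) (N ∷ Δ) = refl

+E-assoc : ∀ Γ Δ Θ → (Γ +E Δ) +E Θ ≡ Γ +E (Δ +E Θ)
+E-assoc []      Δ       Θ       = refl
+E-assoc (M ∷ Γ) []      Θ       = refl
+E-assoc (M ∷ Γ) (N ∷ Δ) []      = refl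
+E-assoc (M ∷ Γ) (N ∷ Δ) (P ∷ Θ) = cong₂ _∷_ (++-assoc M N P) (+E-assoc Γ Δ Θ)

+E-comm : ∀ Γ Δ → (Γ +E Δ) ≈E (Δ +E Γ)
+E-comm []      Δ       = ≡⇒≈E (sym (+E-identityʳ Δ))
+E-comm (M ∷ Γ) []      = ≈E-refl (M ∷ Γ)
+E-comm (M ∷ Γ) (N ∷ Δ) = step (≈M-++-comm M N) (+E-comm Γ Δ)

+E-cong : ∀ {Γ Γ' Δ Δ'} → Γ ≈E Γ' → Δ ≈E Δ' → (Γ +E Δ) ≈E (Γ' +E Δ')
+E-cong [] q = q
+E-cong {Γ} {Γ'} (step h t) [] =
  ≡⇒≈E (+E-identityʳ Γ) ▸ step h t ▸ ≡⇒≈E (sym (+E-identityʳ Γ'))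
+E-cong {Γ} {Γ'} {Δ} {Δ'} (step h t) (step h' t') =
  step (subst₂ _≈M_ (sym (hd-+E Γ Δ)) (sym (hd-+E Γ' Δ')) (≈M-++ h h'))
       (subst₂ _≈E_ (sym (tl-+E Γ Δ)) (sym (tl-+E Γ' Δ')) (+E-cong t t'))

+E-congˡ : ∀ {Γ Γ'} Δ → Γ ≈E Γ' → (Γ +E Δ) ≈E (Γ' +E Δ)
+E-congˡ Δ p = +E-cong p (≈E-refl Δ)

+E-congʳ : ∀ Γ {Δ Δ'} → Δ ≈E Δ' → (Γ +E Δ) ≈E (Γ +E Δ')
+E-congʳ Γ p = +E-cong (≈E-refl Γ) p

+E-[]ˡ : ∀ {Γ} Δ → Γ ≈E [] → (Γ +E Δ) ≈E Δ
+E-[]ˡ Δ p = +E-congˡ Δ p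

+E-[]ʳ : ∀ Γ {Δ} → Δ ≈E [] → (Γ +E Δ) ≈E Γ
+E-[]ʳ Γ p = +E-congʳ Γ p ▸ ≡⇒≈E (+E-identityʳ Γ)

+E-commutativeSemigroup : CommutativeSemigroup _ _
+E-commutativeSemigroup = record
  { Carrier = Env
  ; _≈_     = _≈E_
  ; _∙_     = _+E_
  ; isCommutativeSemigroup = record
    { isSemigroup = record
      { isMagma = record
        { isEquivalence = record { refl = ≈E-refl _ ; sym = ≈E-sym ; trans = ≈E-trans }
        ; ∙-cong        = +E-cong
        }
      ; assoc = λ Γ Δ Θ → ≡⇒≈E (+E-assoc Γ Δ Θ)
      }
    ; comm = +E-comm
    }
  }

open CommutativeSemigroupProperties +E-commutativeSemigroup
  using () renaming (interchange to +E-interchange; x∙yz≈y∙xz to +E-x∙yz≈y∙xz)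

single-cong : ∀ x {L L'} → L ≈L L' → single x L ≈E single x L'
single-cong zero    l = step (ins {M₁ = []} l []) []
single-cong (suc x) l = step [] (single-cong x l)

shiftE : ℕ → Env → Env
shiftE zero    Γ = Γ
shiftE (suc d) Γ = [] ∷ shiftE d Γ

insE : ℕ → ℕ → Env → Env
insE zero    d Γ = shiftE d Γ
insE (suc c) d Γ = hd Γ ∷ insE c d (tl Γ)

delE : ℕ → Env → Env
delE zero    Γ = tl Γ
delE (suc j) Γ = hd Γ ∷ delE j (tl Γ)

at : ℕ → Env → MTy
at zero    Γ = hd Γ
at (suc j) Γ = at j (tl Γ)

shiftE-cong : ∀ d {Γ Δ} → Γ ≈E Δ → shiftE d Γ ≈E shiftE d Δ
shiftE-cong zero    p = p
shiftE-cong (suc d) p = step [] (shiftE-cong d p)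

shiftE-+E : ∀ d Γ Δ → shiftE d (Γ +E Δ) ≈E (shiftE d Γ +E shiftE d Δ)
shiftE-+E zero    Γ Δ = ≈E-refl _
shiftE-+E (suc d) Γ Δ = step [] (shiftE-+E d Γ Δ)

shiftE-[] : ∀ d → shiftE d [] ≈E []
shiftE-[] zero    = []
shiftE-[] (suc d) = step [] (shiftE-[] d)

shiftE-single : ∀ d x L → shiftE d (single x L) ≡ single (x + d) L
shiftE-single zero    x L = cong (λ y → single y L) (sym (+-identityʳ x))
shiftE-single (suc d) x L = trans (cong ([] ∷_) (shiftE-single d x L)) (cong (λ y → single y L) (sym (+-suc x d)))

insE-cong : ∀ c d {Γ Δ} → Γ ≈E Δ → insE c d Γ ≈E insE c d Δ
insE-cong zero    d p = shiftE-cong d p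
insE-cong (suc c) d p = step (≈E-hd p) (insE-cong c d (≈E-tl p))

insE-+E : ∀ c d Γ Δ → insE c d (Γ +E Δ) ≈E (insE c d Γ +E insE c d Δ)
insE-+E zero    d Γ Δ = shiftE-+E d Γ Δ
insE-+E (suc c) d Γ Δ =
  step (≡⇒≈M (hd-+E Γ Δ))
       (subst (λ X → insE c d X ≈E (insE c d (tl Γ) +E insE c d (tl Δ))) (sym (tl-+E Γ Δ)) (insE-+E c d (tl Γ) (tl Δ)))

insE-[] : ∀ c d → insE c d [] ≈E []
insE-[] zero    d = shiftE-[] d
insE-[] (suc c) d = step [] (insE-[] c d)

insE-single-< : ∀ c d x L → x < c → insE c d (single x L) ≈E single x L
insE-single-< (suc c) d zero    L _          = step (≈M-refl _) (insE-[] c d)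
insE-single-< (suc c) d (suc x) L (s≤s x<c) = step [] (insE-single-< c d x L x<c)

insE-single-≥ : ∀ c d x L → c ≤ x → insE c d (single x L) ≈E single (x + d) L
insE-single-≥ zero    d x       L _          = ≡⇒≈E (shiftE-single d x L)
insE-single-≥ (suc c) d (suc x) L (s≤s c≤x) = step [] (insE-single-≥ c d x L c≤x)

delE-cong : ∀ j {Γ Δ} → Γ ≈E Δ → delE j Γ ≈E delE j Δ
delE-cong zero    p = ≈E-tl p
delE-cong (suc j) p = step (≈E-hd p) (delE-cong j (≈E-tl p))

delE-+E : ∀ j Γ Δ → delE j (Γ +E Δ) ≈E (delE j Γ +E delE j Δ)
delE-+E zero    Γ Δ = ≡⇒≈E (tl-+E Γ Δ)
delE-+E (suc j) Γ Δ =
  step (≡⇒≈M (hd-+E Γ Δ))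
       (subst (λ X → delE j X ≈E (delE j (tl Γ) +E delE j (tl Δ))) (sym (tl-+E Γ Δ)) (delE-+E j (tl Γ) (tl Δ)))

delE-[] : ∀ j → delE j [] ≈E []
delE-[] zero    = []
delE-[] (suc j) = step [] (delE-[] j)

delE-single-≡ : ∀ j L → delE j (single j L) ≈E []
delE-single-≡ zero    L = []
delE-single-≡ (suc j) L = step [] (delE-single-≡ j L)

delE-single-< : ∀ j x L → x < j → delE j (single x L) ≈E single x L
delE-single-< (suc j) zero    L _          = step (≈M-refl _) (delE-[] j)
delE-single-< (suc j) (suc x) L (s≤s x<j) = step [] (delE-single-< j x L x<j)

delE-single-> : ∀ j x L → j < x → delE j (single x L) ≈E single (pred x) L
delE-single-> zero    (suc x)       L _          = ≈E-refl _
delE-single-> (suc j) (suc (suc x)) L (s≤s j<x) = step [] (delE-single-> j (suc x) L j<x)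

at-cong : ∀ j {Γ Δ} → Γ ≈E Δ → at j Γ ≈M at j Δ
at-cong zero    p = ≈E-hd p
at-cong (suc j) p = at-cong j (≈E-tl p)

at-+E : ∀ j Γ Δ → at j (Γ +E Δ) ≡ at j Γ ++ at j Δ
at-+E zero    Γ Δ = hd-+E Γ Δ
at-+E (suc j) Γ Δ = trans (cong (at j) (tl-+E Γ Δ)) (at-+E j (tl Γ) (tl Δ))

at-[] : ∀ j → at j [] ≡ []
at-[] zero    = refl
at-[] (suc j) = at-[] j

at-≈[] : ∀ j {Γ} → Γ ≈E [] → at j Γ ≡ []
at-≈[] j {Γ} p = ≈M-[] (subst (at j Γ ≈M_) (at-[] j) (at-cong j p))

at-single-≡ : ∀ j L → at j (single j L) ≡ L ∷ []
at-single-≡ zero    L = refl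
at-single-≡ (suc j) L = at-single-≡ j L

at-single-≢ : ∀ j x L → x ≢ j → at j (single x L) ≡ []
at-single-≢ zero    zero    L x≢j = ⊥-elim (x≢j refl)
at-single-≢ zero    (suc x) L x≢j = refl
at-single-≢ (suc j) zero    L x≢j = at-[] j
at-single-≢ (suc j) (suc x) L x≢j = at-single-≢ j x L (λ e → x≢j (cong suc e))

takeE : ℕ → Env → Env
takeE zero    Θ = []
takeE (suc n) Θ = hd Θ ∷ takeE n (tl Θ)

dropE : ℕ → Env → Env
dropE zero    Θ = Θ
dropE (suc n) Θ = dropE n (tl Θ)

length-takeE : ∀ n Θ → length (takeE n Θ) ≡ n
length-takeE zero    Θ = refl
length-takeE (suc n) Θ = cong suc (length-takeE n (tl Θ))

takeE++dropE : ∀ n Θ → Θ ≈E (takeE n Θ ++ dropE n Θ)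
takeE++dropE zero    Θ = ≈E-refl Θ
takeE++dropE (suc n) Θ = ≈E-hd∷tl Θ ▸ step (≈M-refl (hd Θ)) (takeE++dropE n (tl Θ))

singleM : ℕ → MTy → Env
singleM zero    M = M ∷ []
singleM (suc x) M = [] ∷ singleM x M

singleM-[] : ∀ x → singleM x [] ≈E []
singleM-[] zero    = step [] []
singleM-[] (suc x) = step [] (singleM-[] x)

single-+E-singleM : ∀ x L M → single x L +E singleM x M ≡ singleM x (L ∷ M)
single-+E-singleM zero    L M = refl
single-+E-singleM (suc x) L M = cong ([] ∷_) (single-+E-singleM x L M)

singleM-+E-∷ʳ : ∀ p M Rs → length Rs ≡ p → (singleM p M +E Rs) ≈E (Rs ++ M ∷ [])
singleM-+E-∷ʳ zero    M []       refl = ≈E-refl _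
singleM-+E-∷ʳ (suc p) M (R ∷ Rs) refl = step (≈M-refl R) (singleM-+E-∷ʳ p M Rs refl)

single-+E-shiftE : ∀ p y A Θ Rs → length Rs ≡ p →
  (single (p + y) A +E (shiftE p Θ +E Rs)) ≈E (Rs ++ (single y A +E Θ))
single-+E-shiftE zero    y A Θ []       refl = ≡⇒≈E (cong (single y A +E_) (+E-identityʳ Θ))
single-+E-shiftE (suc p) y A Θ (R ∷ Rs) refl = step (≈M-refl R) (single-+E-shiftE p y A Θ Rs refl)



-- Whitening of environments

WhE-≡ : ∀ {a k k' Γ' Γ} → k ≡ k' → WhE a k Γ' Γ → WhE a k' Γ' Γ
WhE-≡ refl w = w

WhE-≈ʳ : ∀ {a k Γ' Γ Δ} → WhE a k Γ' Γ → Γ ≈E Δ → WhE a k Γ' Δ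
WhE-≈ʳ []         []            = []
WhE-≈ʳ []         (step h t)    = step (WhM-≈ʳ [] h) (WhE-≈ʳ [] t)
WhE-≈ʳ (step h t) []            = step h t
WhE-≈ʳ (step h t) (step h' t') = step (WhM-≈ʳ h h') (WhE-≈ʳ t t')

WhE-≈ˡ : ∀ {a k Γ'' Γ' Γ} → Γ'' ≈E Γ' → WhE a k Γ' Γ → WhE a k Γ'' Γ
WhE-≈ˡ []         []            = []
WhE-≈ˡ (step h t) []            = step (WhM-≈ˡ h []) (WhE-≈ˡ t [])
WhE-≈ˡ []         (step h t)    = step h t
WhE-≈ˡ (step h t) (step h' t') = step (WhM-≈ˡ h h') (WhE-≈ˡ t t')

WhE-+E : ∀ {a k₁ k₂ A' A B' B} → WhE a k₁ A' A → WhE a k₂ B' B → WhE a (k₁ + k₂) (A' +E B') (A +E B)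
WhE-+E [] q = q
WhE-+E {k₁ = k₁} {A' = A'} {A} (step h t) [] =
  WhE-≡ (sym (+-identityʳ k₁)) (subst₂ (WhE _ _) (sym (+E-identityʳ A')) (sym (+E-identityʳ A)) (step h t))
WhE-+E {A' = A'} {A} {B'} {B} (step {k₁ = a} {k₂ = b} h t) (step {k₁ = c} {k₂ = d} h' t') =
  WhE-≡ (interchange a c b d)
    (step (subst₂ (WhM _ _) (sym (hd-+E A' B')) (sym (hd-+E A B)) (WhM-++ h h'))
          (subst₂ (WhE _ _) (sym (tl-+E A' B')) (sym (tl-+E A B)) (WhE-+E t t')))

WhE-single : ∀ {a k L' L} x → Wh a k L' L → WhE a k (single x L') (single x L)
WhE-single {k = k} zero w = WhE-≡ (trans (+-identityʳ _) (+-identityʳ k)) (step (ins {M₁ = []} w []) [])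
WhE-single (suc x)     w = step [] (WhE-single x w)

data WhMs (a : Pol) : ℕ → List MTy → List MTy → Set where
  []  : WhMs a 0 [] []
  _∷_ : ∀ {k₁ k₂ M' M Ms' Ms} → WhM a k₁ M' M → WhMs a k₂ Ms' Ms → WhMs a (k₁ + k₂) (M' ∷ Ms') (M ∷ Ms)

WhE-++⁻¹ : ∀ {a k X Y} A B → length A ≡ length B → WhE a k (A ++ X) (B ++ Y) →
  Σ[ k₁ ∈ ℕ ] Σ[ k₂ ∈ ℕ ] (WhMs a k₁ A B × WhE a k₂ X Y × k ≡ k₁ + k₂)
WhE-++⁻¹ []      []      eq w = 0 , _ , [] , w , refl
WhE-++⁻¹ (_ ∷ A) (_ ∷ B) eq (step {k₁ = j} h t) with WhE-++⁻¹ A B (suc-injective eq) t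
... | k₁ , k₂ , ms , w , refl = j + k₁ , k₂ , h ∷ ms , w , sym (+-assoc j k₁ k₂)

WhMs-++⁻¹ : ∀ {a k} A B {Ms} → WhMs a k (A ++ B) Ms →
  Σ[ Ms₁ ∈ List MTy ] Σ[ Ms₂ ∈ List MTy ] Σ[ k₁ ∈ ℕ ] Σ[ k₂ ∈ ℕ ]
    (Ms ≡ Ms₁ ++ Ms₂ × WhMs a k₁ A Ms₁ × WhMs a k₂ B Ms₂ × k ≡ k₁ + k₂)
WhMs-++⁻¹ []      B {Ms} w = [] , Ms , 0 , _ , refl , [] , w , refl
WhMs-++⁻¹ (_ ∷ A) B (_∷_ {k₁ = j} {M = M} m ms) with WhMs-++⁻¹ A B ms
... | Ms₁ , Ms₂ , k₁ , k₂ , refl , w₁ , w₂ , refl = M ∷ Ms₁ , Ms₂ , j + k₁ , k₂ , refl , m ∷ w₁ , w₂ , sym (+-assoc j k₁ k₂)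

WhMs-[]⁻¹ : ∀ {a k Ms} → WhMs a k [] Ms → Ms ≡ [] × k ≡ 0
WhMs-[]⁻¹ [] = refl , refl

WhMs-[-]⁻¹ : ∀ {a k M Ms} → WhMs a k (M ∷ []) Ms → Σ[ M₀ ∈ MTy ] (Ms ≡ M₀ ∷ [] × WhM a k M M₀)
WhMs-[-]⁻¹ (_∷_ {k₁ = k₁} m []) = _ , refl , WhM-≡ (sym (+-identityʳ k₁)) m



-- Sized derivations

-- Γ ⊢[ k ]⟨ n ⟩ t ∶ L: Γ ⊢ᵏ t• : L by a derivation of size n (its number of ax, λ and @ rules),
-- where (many) lists its premises in order and all environments are taken up to ≈E.
infix 4 _⊢[_]⟨_⟩_∶_ _⊢[_]⟨_⟩_∶M_

mutual
  data _⊢[_]⟨_⟩_∶_ : Env → ℕ → ℕ → Term → LTy → Set where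
    ax  : ∀ {Γ x L} → Γ ≈E single x L → Γ ⊢[ 0 ]⟨ 1 ⟩ var x ∶ L
    lam : ∀ {Γ M k n t L} → M ∷ Γ ⊢[ k ]⟨ n ⟩ t ∶ L → Γ ⊢[ k ]⟨ suc n ⟩ lam t ∶ arr M black L
    app : ∀ {Γ Γ₁ Γ₂ k₁ k₂ n₁ n₂ t u c M L} →
          Γ₁ ⊢[ k₁ ]⟨ n₁ ⟩ t ∶ arr M c L → Γ₂ ⊢[ k₂ ]⟨ n₂ ⟩ u ∶M M → Γ ≈E (Γ₁ +E Γ₂) →
          Γ ⊢[ k₁ + k₂ + cost c black ]⟨ suc (n₁ + n₂) ⟩ app t u ∶ L

  data _⊢[_]⟨_⟩_∶M_ : Env → ℕ → ℕ → Term → MTy → Set where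
    nil  : ∀ {Γ t} → Γ ≈E [] → Γ ⊢[ 0 ]⟨ 0 ⟩ t ∶M []
    cons : ∀ {Γ Γ₁ Γ₂ k₁ k₂ n₁ n₂ t L M} →
           Γ₁ ⊢[ k₁ ]⟨ n₁ ⟩ t ∶ L → Γ₂ ⊢[ k₂ ]⟨ n₂ ⟩ t ∶M M → Γ ≈E (Γ₁ +E Γ₂) →
           Γ ⊢[ k₁ + k₂ ]⟨ n₁ + n₂ ⟩ t ∶M L ∷ M

reindex : ∀ {Γ k k' n n' t L} → k ≡ k' → n ≡ n' → Γ ⊢[ k ]⟨ n ⟩ t ∶ L → Γ ⊢[ k' ]⟨ n' ⟩ t ∶ L
reindex refl refl D = D

reindexM : ∀ {Γ k k' n n' t M} → k ≡ k' → n ≡ n' → Γ ⊢[ k ]⟨ n ⟩ t ∶M M → Γ ⊢[ k' ]⟨ n' ⟩ t ∶M M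
reindexM refl refl D = D

Der-≈ : ∀ {Γ Γ' k n t L L'} → Γ ⊢[ k ]⟨ n ⟩ t ∶ L → Γ ≈E Γ' → L ≈L L' → Γ' ⊢[ k ]⟨ n ⟩ t ∶ L'
Der-≈ (ax {x = x} e)        p l         = ax (≈E-sym p ▸ e ▸ single-cong x l)
Der-≈ (lam D)               p (arr m l) = lam (Der-≈ D (step m p) l)
Der-≈ (app {M = M} D Ds e) p l         = app (Der-≈ D (≈E-refl _) (arr (≈M-refl M) l)) Ds (≈E-sym p ▸ e)

Der-≈E : ∀ {Γ Γ' k n t L} → Γ ⊢[ k ]⟨ n ⟩ t ∶ L → Γ ≈E Γ' → Γ' ⊢[ k ]⟨ n ⟩ t ∶ L
Der-≈E D p = Der-≈ D p (≈L-refl _)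

DerM-≈E : ∀ {Γ Γ' k n t M} → Γ ⊢[ k ]⟨ n ⟩ t ∶M M → Γ ≈E Γ' → Γ' ⊢[ k ]⟨ n ⟩ t ∶M M
DerM-≈E (nil e)        p = nil (≈E-sym p ▸ e)
DerM-≈E (cons D Ds e) p = cons D Ds (≈E-sym p ▸ e)

DerM-insert : ∀ M₁ {M₂ Γ Δ k₁ k₂ n₁ n₂ t L} →
  Γ ⊢[ k₁ ]⟨ n₁ ⟩ t ∶ L → Δ ⊢[ k₂ ]⟨ n₂ ⟩ t ∶M M₁ ++ M₂ →
  Γ +E Δ ⊢[ k₁ + k₂ ]⟨ n₁ + n₂ ⟩ t ∶M M₁ ++ L ∷ M₂
DerM-insert []       D Ds = cons D Ds (≈E-refl _)
DerM-insert (_ ∷ M₁) {Γ = Γ} {k₁ = k₁} {n₁ = n₁} D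
            (cons {Γ₁ = Γ₁} {Γ₂ = Γ₂} {k₁ = k₃} {k₂ = k₄} {n₁ = n₃} {n₂ = n₄} D' Ds e) =
  reindexM (x∙yz≈y∙xz k₃ k₁ k₄) (x∙yz≈y∙xz n₃ n₁ n₄)
    (cons D' (DerM-insert M₁ D Ds) (+E-congʳ Γ e ▸ +E-x∙yz≈y∙xz Γ Γ₁ Γ₂))

DerM-perm : ∀ {Γ k n t M M'} → Γ ⊢[ k ]⟨ n ⟩ t ∶M M → M ≈M M' → Γ ⊢[ k ]⟨ n ⟩ t ∶M M'
DerM-perm (nil e)        []                  = nil e
DerM-perm (cons D Ds e) (ins {M₁ = M₁} l m) =
  DerM-≈E (DerM-insert M₁ (Der-≈ D (≈E-refl _) l) (DerM-perm Ds m)) (≈E-sym e)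

DerM-split : ∀ A {B Γ k n t} → Γ ⊢[ k ]⟨ n ⟩ t ∶M A ++ B →
  Σ[ Γa ∈ Env ] Σ[ Γb ∈ Env ] Σ[ ka ∈ ℕ ] Σ[ kb ∈ ℕ ] Σ[ na ∈ ℕ ] Σ[ nb ∈ ℕ ]
    (Γa ⊢[ ka ]⟨ na ⟩ t ∶M A × Γb ⊢[ kb ]⟨ nb ⟩ t ∶M B × Γ ≈E (Γa +E Γb) × k ≡ ka + kb × n ≡ na + nb)
DerM-split []      {Γ = Γ} Ds = [] , Γ , 0 , _ , 0 , _ , nil [] , Ds , ≈E-refl Γ , refl , refl
DerM-split (_ ∷ A) (cons {Γ₁ = Γ₁} {k₁ = k₁} {n₁ = n₁} D Ds e) with DerM-split A Ds
... | Γa , Γb , ka , kb , na , nb , Da , Db , e' , refl , refl =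
  Γ₁ +E Γa , Γb , k₁ + ka , kb , n₁ + na , nb , cons D Da (≈E-refl _) , Db ,
  (e ▸ +E-congʳ Γ₁ e' ▸ ≡⇒≈E (sym (+E-assoc Γ₁ Γa Γb))) , sym (+-assoc k₁ ka kb) , sym (+-assoc n₁ na nb)

DerM-++ : ∀ {A B Γa Γb ka kb na nb t} → Γa ⊢[ ka ]⟨ na ⟩ t ∶M A → Γb ⊢[ kb ]⟨ nb ⟩ t ∶M B →
  Γa +E Γb ⊢[ ka + kb ]⟨ na + nb ⟩ t ∶M A ++ B
DerM-++ {Γb = Γb} (nil e)        Db = DerM-≈E Db (≈E-sym (+E-[]ˡ Γb e))
DerM-++ {Γb = Γb} (cons {Γ₁ = Γ₁} {Γ₂ = Γ₂} {k₁ = k₁} {k₂ = k₂} {n₁ = n₁} {n₂ = n₂} D Ds e) Db =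
  reindexM (sym (+-assoc k₁ k₂ _)) (sym (+-assoc n₁ n₂ _))
    (cons D (DerM-++ Ds Db) (+E-congˡ Γb e ▸ ≡⇒≈E (+E-assoc Γ₁ Γ₂ Γb)))

DerM-singleton : ∀ {Γ k n t L} → Γ ⊢[ k ]⟨ n ⟩ t ∶ L → Γ ⊢[ k ]⟨ n ⟩ t ∶M L ∷ []
DerM-singleton {Γ} {k} {n} D =
  reindexM (+-identityʳ k) (+-identityʳ n) (cons D (nil []) (≡⇒≈E (sym (+E-identityʳ Γ))))

DerM-singleton⁻¹ : ∀ {Γ k n t L} → Γ ⊢[ k ]⟨ n ⟩ t ∶M L ∷ [] → Γ ⊢[ k ]⟨ n ⟩ t ∶ L
DerM-singleton⁻¹ (cons {k₁ = k₁} {n₁ = n₁} D (nil e') e) =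
  reindex (sym (+-identityʳ k₁)) (sym (+-identityʳ n₁)) (Der-≈E D (≈E-sym (e ▸ +E-[]ʳ _ e')))

DerM-[]⁻¹ : ∀ {Γ k n t M} → Γ ⊢[ k ]⟨ n ⟩ t ∶M M → M ≈M [] → Γ ≈E [] × k ≡ 0 × n ≡ 0
DerM-[]⁻¹ Ds m with ≈M-[] m
DerM-[]⁻¹ (nil e) m | refl = e , refl , refl

mutual
  ⊢⇒Der : ∀ t {Γ k L} → Γ ⊢[ k ] paint t ∶ L → Σ[ n ∈ ℕ ] Γ ⊢[ k ]⟨ n ⟩ t ∶ L
  ⊢⇒Der (var x)   (ax e)  = 1 , ax e
  ⊢⇒Der (lam t)   (lam D) with ⊢⇒Der t D
  ... | n , D' = suc n , lam D'
  ⊢⇒Der (app t u) (app D Ds m e) with ⊢⇒Der t D | ⊢⇒DerM u Ds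
  ... | _ , D' | _ , Ds' = _ , app D' (DerM-perm Ds' (≈M-sym m)) e

  ⊢⇒DerM : ∀ t {Γ k M} → Γ ⊢[ k ] paint t ∶M M → Σ[ n ∈ ℕ ] Γ ⊢[ k ]⟨ n ⟩ t ∶M M
  ⊢⇒DerM t []       = 0 , nil []
  ⊢⇒DerM t (D ∷ Ds) with ⊢⇒Der t D | ⊢⇒DerM t Ds
  ... | _ , D' | _ , Ds' = _ , cons D' Ds' (≈E-refl _)

mutual
  Der⇒⊢ : ∀ {Γ k n t L} → Γ ⊢[ k ]⟨ n ⟩ t ∶ L → Γ ⊢[ k ] paint t ∶ L
  Der⇒⊢ (ax e)  = ax e
  Der⇒⊢ (lam D) = lam (Der⇒⊢ D)
  Der⇒⊢ (app {Γ₁ = Γ₁} {M = M} D Ds e) with DerM⇒⊢ Ds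
  ... | _ , e' , Ds' = app (Der⇒⊢ D) Ds' (≈M-refl M) (e ▸ +E-congʳ Γ₁ e')

  DerM⇒⊢ : ∀ {Γ k n t M} → Γ ⊢[ k ]⟨ n ⟩ t ∶M M → Σ[ Γ₀ ∈ Env ] (Γ ≈E Γ₀ × Γ₀ ⊢[ k ] paint t ∶M M)
  DerM⇒⊢ (nil e)                   = [] , e , []
  DerM⇒⊢ (cons {Γ₁ = Γ₁} D Ds e) with DerM⇒⊢ Ds
  ... | Γ₀ , e' , Ds' = Γ₁ +E Γ₀ , (e ▸ +E-congʳ Γ₁ e') , Der⇒⊢ D ∷ Ds'

DerM-var⁻¹ : ∀ {Θ k n x M} → Θ ⊢[ k ]⟨ n ⟩ var x ∶M M → k ≡ 0 × Θ ≈E singleM x M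
DerM-var⁻¹ {x = x} (nil e) = refl , (e ▸ ≈E-sym (singleM-[] x))
DerM-var⁻¹ {x = x} (cons (ax {L = L} e₁) Ds e) with DerM-var⁻¹ Ds
... | refl , e₂ = refl , (e ▸ +E-cong e₁ e₂ ▸ ≡⇒≈E (single-+E-singleM x L _))



-- Weakening and substitution

lift-var-< : ∀ d {c x} → x < c → lift d c (var x) ≡ var x
lift-var-< d {c} {x} x<c with x <ᵇ c in eq
... | true  = refl
... | false = ⊥-elim (subst T eq (<⇒<ᵇ x<c))

lift-var-≥ : ∀ d {c x} → c ≤ x → lift d c (var x) ≡ var (x + d)
lift-var-≥ d {c} {x} c≤x with x <ᵇ c in eq
... | false = refl
... | true  = ⊥-elim (<⇒≱ (<ᵇ⇒< x c (subst T (sym eq) _)) c≤x)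

sub-var-≡ : ∀ j s → sub j s (var j) ≡ lift j 0 s
sub-var-≡ j s with j ≡ᵇ j in eq
... | true  = refl
... | false = ⊥-elim (subst T eq (≡⇒≡ᵇ j j refl))

sub-var-< : ∀ s {j x} → x < j → sub j s (var x) ≡ var x
sub-var-< s {j} {x} x<j with x ≡ᵇ j in eq₁ | j <ᵇ x in eq₂
... | false | false = refl
... | true  | _     = ⊥-elim (<⇒≢ x<j (≡ᵇ⇒≡ x j (subst T (sym eq₁) _)))
... | false | true  = ⊥-elim (<-asym x<j (<ᵇ⇒< j x (subst T (sym eq₂) _)))

sub-var-> : ∀ s {j x} → j < x → sub j s (var x) ≡ var (pred x)
sub-var-> s {j} {x} j<x with x ≡ᵇ j in eq₁ | j <ᵇ x in eq₂
... | false | true  = refl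
... | true  | _     = ⊥-elim (<⇒≢ j<x (sym (≡ᵇ⇒≡ x j (subst T (sym eq₁) _))))
... | false | false = ⊥-elim (subst T eq₂ (<⇒<ᵇ j<x))

mutual
  Der-lift : ∀ c d {Γ k n t L} → Γ ⊢[ k ]⟨ n ⟩ t ∶ L → insE c d Γ ⊢[ k ]⟨ n ⟩ lift d c t ∶ L
  Der-lift c d (ax {x = x} {L = L} e) with x <? c
  ... | yes x<c rewrite lift-var-< d x<c = ax (insE-cong c d e ▸ insE-single-< c d x L x<c)
  ... | no  x≮c rewrite lift-var-≥ d (≮⇒≥ x≮c) = ax (insE-cong c d e ▸ insE-single-≥ c d x L (≮⇒≥ x≮c))
  Der-lift c d (lam D) = lam (Der-lift (suc c) d D)
  Der-lift c d (app {Γ₁ = Γ₁} {Γ₂ = Γ₂} D Ds e) =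
    app (Der-lift c d D) (DerM-lift c d Ds) (insE-cong c d e ▸ insE-+E c d Γ₁ Γ₂)

  DerM-lift : ∀ c d {Γ k n t M} → Γ ⊢[ k ]⟨ n ⟩ t ∶M M → insE c d Γ ⊢[ k ]⟨ n ⟩ lift d c t ∶M M
  DerM-lift c d (nil e) = nil (insE-cong c d e ▸ insE-[] c d)
  DerM-lift c d (cons {Γ₁ = Γ₁} {Γ₂ = Γ₂} D Ds e) =
    cons (Der-lift c d D) (DerM-lift c d Ds) (insE-cong c d e ▸ insE-+E c d Γ₁ Γ₂)

mutual
  Der-lift⁻¹ : ∀ c d t {Θ k n L} → Θ ⊢[ k ]⟨ n ⟩ lift d c t ∶ L →
    Σ[ Γ ∈ Env ] (Θ ≈E insE c d Γ × Γ ⊢[ k ]⟨ n ⟩ t ∶ L)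
  Der-lift⁻¹ c d (var x) D with x <? c
  ... | yes x<c rewrite lift-var-< d x<c with D
  ...   | ax {L = L} e = single x L , (e ▸ ≈E-sym (insE-single-< c d x L x<c)) , ax (≈E-refl _)
  Der-lift⁻¹ c d (var x) D | no x≮c rewrite lift-var-≥ d (≮⇒≥ x≮c) with D
  ...   | ax {L = L} e = single x L , (e ▸ ≈E-sym (insE-single-≥ c d x L (≮⇒≥ x≮c))) , ax (≈E-refl _)
  Der-lift⁻¹ c d (lam t) (lam D) with Der-lift⁻¹ (suc c) d t D
  ... | Γ , e , D' = tl Γ , ≈E-tl e , lam (Der-≈E D' (≈E-hd∷tl Γ ▸ step (≈M-sym (≈E-hd e)) (≈E-refl _)))
  Der-lift⁻¹ c d (app t u) (app D Ds e) with Der-lift⁻¹ c d t D | DerM-lift⁻¹ c d u Ds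
  ... | Γa , ea , Da | Γb , eb , Db =
    Γa +E Γb , (e ▸ +E-cong ea eb ▸ ≈E-sym (insE-+E c d Γa Γb)) , app Da Db (≈E-refl _)

  DerM-lift⁻¹ : ∀ c d t {Θ k n M} → Θ ⊢[ k ]⟨ n ⟩ lift d c t ∶M M →
    Σ[ Γ ∈ Env ] (Θ ≈E insE c d Γ × Γ ⊢[ k ]⟨ n ⟩ t ∶M M)
  DerM-lift⁻¹ c d t (nil e) = [] , (e ▸ ≈E-sym (insE-[] c d)) , nil []
  DerM-lift⁻¹ c d t (cons D Ds e) with Der-lift⁻¹ c d t D | DerM-lift⁻¹ c d t Ds
  ... | Γa , ea , Da | Γb , eb , Db =
    Γa +E Γb , (e ▸ +E-cong ea eb ▸ ≈E-sym (insE-+E c d Γa Γb)) , cons Da Db (≈E-refl _)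

subE : ℕ → Env → Env → Env
subE j Θ Δ = delE j Θ +E shiftE j Δ

subE-cong : ∀ j {Θ Θ' Δ Δ'} → Θ ≈E Θ' → Δ ≈E Δ' → subE j Θ Δ ≈E subE j Θ' Δ'
subE-cong j p q = +E-cong (delE-cong j p) (shiftE-cong j q)

subE-+E : ∀ j Θ₁ Θ₂ Δ₁ Δ₂ → subE j (Θ₁ +E Θ₂) (Δ₁ +E Δ₂) ≈E (subE j Θ₁ Δ₁ +E subE j Θ₂ Δ₂)
subE-+E j Θ₁ Θ₂ Δ₁ Δ₂ =
  +E-cong (delE-+E j Θ₁ Θ₂) (shiftE-+E j Δ₁ Δ₂) ▸
  +E-interchange (delE j Θ₁) (delE j Θ₂) (shiftE j Δ₁) (shiftE j Δ₂)

subE-[] : ∀ j → subE j [] [] ≈E []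
subE-[] j = +E-cong (delE-[] j) (shiftE-[] j)

DerM-at-split : ∀ j {Θ} Θ₁ Θ₂ {Δ k n s} → Θ ≈E (Θ₁ +E Θ₂) → Δ ⊢[ k ]⟨ n ⟩ s ∶M at j Θ →
  Σ[ Δ₁ ∈ Env ] Σ[ Δ₂ ∈ Env ] Σ[ k₁ ∈ ℕ ] Σ[ k₂ ∈ ℕ ] Σ[ n₁ ∈ ℕ ] Σ[ n₂ ∈ ℕ ]
    (Δ₁ ⊢[ k₁ ]⟨ n₁ ⟩ s ∶M at j Θ₁ × Δ₂ ⊢[ k₂ ]⟨ n₂ ⟩ s ∶M at j Θ₂ ×
     Δ ≈E (Δ₁ +E Δ₂) × k ≡ k₁ + k₂ × n ≡ n₁ + n₂)
DerM-at-split j {Θ} Θ₁ Θ₂ e Ds =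
  DerM-split (at j Θ₁) (DerM-perm Ds (subst (at j Θ ≈M_) (at-+E j Θ₁ Θ₂) (at-cong j e)))

+-app-shuffle : ∀ k₁ k₂ k₃ k₄ c → (k₁ + k₃) + (k₂ + k₄) + c ≡ (k₁ + k₂ + c) + (k₃ + k₄)
+-app-shuffle = solve-∀

Der-sub-var≢ : ∀ j {x y L Θ Δ k n s} → x ≢ j → delE j (single x L) ≈E single y L →
  Θ ≈E single x L → Δ ⊢[ k ]⟨ n ⟩ s ∶M at j Θ → subE j Θ Δ ⊢[ k ]⟨ suc n ⟩ var y ∶ L
Der-sub-var≢ j {x} {L = L} {Θ} x≢j eq e Ds
  with DerM-[]⁻¹ Ds (subst (at j Θ ≈M_) (at-single-≢ j x L x≢j) (at-cong j e))
... | eΔ , refl , refl = ax (subE-cong j e eΔ ▸ +E-[]ʳ _ (shiftE-[] j) ▸ eq)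

mutual
  Der-sub : ∀ j s t {Θ k n L Δ k' n'} → Θ ⊢[ k ]⟨ n ⟩ t ∶ L → Δ ⊢[ k' ]⟨ n' ⟩ s ∶M at j Θ →
    Σ[ m ∈ ℕ ] (m ≤ n + n' × subE j Θ Δ ⊢[ k + k' ]⟨ m ⟩ sub j s t ∶ L)
  Der-sub j s (var x) {Θ} {Δ = Δ} (ax {L = L} e) Ds with <-cmp x j
  ... | tri≈ _ refl _ rewrite sub-var-≡ x s =
    _ , n≤1+n _ ,
    Der-≈E (Der-lift 0 x (DerM-singleton⁻¹ (DerM-perm Ds (subst (at x Θ ≈M_) (at-single-≡ x L) (at-cong x e)))))
           (≈E-sym (+E-[]ˡ (shiftE x Δ) (delE-cong x e ▸ delE-single-≡ x L)))
  ... | tri< x<j _ _ rewrite sub-var-< s x<j =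
    _ , ≤-refl , Der-sub-var≢ j (<⇒≢ x<j) (delE-single-< j x L x<j) e Ds
  ... | tri> _ _ j<x rewrite sub-var-> s j<x =
    _ , ≤-refl , Der-sub-var≢ j (>⇒≢ j<x) (delE-single-> j x L j<x) e Ds
  Der-sub j s (lam t) (lam {M = M} D) Ds with Der-sub (suc j) s t D Ds
  ... | m , m≤ , D' = suc m , s≤s m≤ , lam (Der-≈E D' (step (≡⇒≈M (++-identityʳ M)) (≈E-refl _)))
  Der-sub j s (app t u) {Δ = Δ}
          (app {Γ₁ = Θ₁} {Γ₂ = Θ₂} {k₁ = k₁} {k₂ = k₂} {n₁ = n₁} {n₂ = n₂} {c = c} D Ds₁ e) Ds
    with DerM-at-split j Θ₁ Θ₂ e Ds
  ... | Δ₁ , Δ₂ , k₃ , k₄ , n₃ , n₄ , Ds₃ , Ds₄ , eΔ , refl , refl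
    with Der-sub j s t D Ds₃ | DerM-sub j s u Ds₁ Ds₄
  ... | m₁ , m₁≤ , D' | m₂ , m₂≤ , Ds' =
    suc (m₁ + m₂) , s≤s (≤-trans (+-mono-≤ m₁≤ m₂≤) (≤-reflexive (interchange n₁ n₃ n₂ n₄))) ,
    reindex (+-app-shuffle k₁ k₂ k₃ k₄ (cost c black)) refl
      (app D' Ds' (subE-cong j e eΔ ▸ subE-+E j Θ₁ Θ₂ Δ₁ Δ₂))

  DerM-sub : ∀ j s u {Θ k n M Δ k' n'} → Θ ⊢[ k ]⟨ n ⟩ u ∶M M → Δ ⊢[ k' ]⟨ n' ⟩ s ∶M at j Θ →
    Σ[ m ∈ ℕ ] (m ≤ n + n' × subE j Θ Δ ⊢[ k + k' ]⟨ m ⟩ sub j s u ∶M M)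
  DerM-sub j s u (nil e) Ds with DerM-[]⁻¹ Ds (≡⇒≈M (at-≈[] j e))
  ... | eΔ , refl , refl = 0 , z≤n , nil (subE-cong j e eΔ ▸ subE-[] j)
  DerM-sub j s u (cons {Γ₁ = Θ₁} {Γ₂ = Θ₂} {k₁ = k₁} {k₂ = k₂} {n₁ = n₁} {n₂ = n₂} D Ds₁ e) Ds
    with DerM-at-split j Θ₁ Θ₂ e Ds
  ... | Δ₁ , Δ₂ , k₃ , k₄ , n₃ , n₄ , Ds₃ , Ds₄ , eΔ , refl , refl
    with Der-sub j s u D Ds₃ | DerM-sub j s u Ds₁ Ds₄
  ... | m₁ , m₁≤ , D' | m₂ , m₂≤ , Ds' =
    m₁ + m₂ , ≤-trans (+-mono-≤ m₁≤ m₂≤) (≤-reflexive (interchange n₁ n₃ n₂ n₄)) ,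
    reindexM (interchange k₁ k₃ k₂ k₄) refl
      (cons D' Ds' (subE-cong j e eΔ ▸ subE-+E j Θ₁ Θ₂ Δ₁ Δ₂))

DerM-[]-at-single : ∀ j {x L s} → x ≢ j → [] ⊢[ 0 ]⟨ 0 ⟩ s ∶M at j (single x L)
DerM-[]-at-single j {x} {L} x≢j = subst ([] ⊢[ 0 ]⟨ 0 ⟩ _ ∶M_) (sym (at-single-≢ j x L x≢j)) (nil [])

subE-single-[] : ∀ j {x y L} → delE j (single x L) ≈E single y L → single y L ≈E subE j (single x L) []
subE-single-[] j eq = ≈E-sym eq ▸ ≈E-sym (+E-[]ʳ _ (shiftE-[] j))

mutual
  Der-sub⁻¹ : ∀ j s t {Θ k n L} → Θ ⊢[ k ]⟨ n ⟩ sub j s t ∶ L →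
    Σ[ Γ ∈ Env ] Σ[ Δ ∈ Env ] Σ[ k₁ ∈ ℕ ] Σ[ k₂ ∈ ℕ ] Σ[ n₁ ∈ ℕ ] Σ[ n₂ ∈ ℕ ]
      (Γ ⊢[ k₁ ]⟨ n₁ ⟩ t ∶ L × Δ ⊢[ k₂ ]⟨ n₂ ⟩ s ∶M at j Γ × Θ ≈E subE j Γ Δ × k ≡ k₁ + k₂)
  Der-sub⁻¹ j s (var x) {k = k} {n} {L} D with <-cmp x j
  ... | tri≈ _ refl _ rewrite sub-var-≡ x s with Der-lift⁻¹ 0 x s D
  ...   | Δ , e , D' =
    single x L , Δ , 0 , k , 1 , n , ax (≈E-refl _) ,
    subst (Δ ⊢[ k ]⟨ n ⟩ s ∶M_) (sym (at-single-≡ x L)) (DerM-singleton D') ,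
    (e ▸ ≈E-sym (+E-[]ˡ (shiftE x Δ) (delE-single-≡ x L))) , refl
  Der-sub⁻¹ j s (var x) {L = L} D | tri< x<j _ _ rewrite sub-var-< s x<j with D
  ...   | ax e = single x L , [] , 0 , 0 , 1 , 0 , ax (≈E-refl _) , DerM-[]-at-single j (<⇒≢ x<j) ,
                 (e ▸ subE-single-[] j (delE-single-< j x L x<j)) , refl
  Der-sub⁻¹ j s (var x) {L = L} D | tri> _ _ j<x rewrite sub-var-> s j<x with D
  ...   | ax e = single x L , [] , 0 , 0 , 1 , 0 , ax (≈E-refl _) , DerM-[]-at-single j (>⇒≢ j<x) ,
                 (e ▸ subE-single-[] j (delE-single-> j x L j<x)) , refl
  Der-sub⁻¹ j s (lam t) (lam D) with Der-sub⁻¹ (suc j) s t D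
  ... | Γ , Δ , k₁ , k₂ , n₁ , n₂ , D' , Ds , e , refl =
    tl Γ , Δ , k₁ , k₂ , suc n₁ , n₂ ,
    lam (Der-≈E D' (≈E-hd∷tl Γ ▸ step (≈M-sym (≈M-trans (≈E-hd e) (≡⇒≈M (++-identityʳ (hd Γ))))) (≈E-refl _))) ,
    Ds , ≈E-tl e , refl
  Der-sub⁻¹ j s (app t u) (app {c = c} D Ds e) with Der-sub⁻¹ j s t D | DerM-sub⁻¹ j s u Ds
  ... | Γ₁ , Δ₁ , k₁ , k₃ , _ , _ , D₁ , Ds₁ , e₁ , refl | Γ₂ , Δ₂ , k₂ , k₄ , _ , _ , D₂ , Ds₂ , e₂ , refl =
    Γ₁ +E Γ₂ , Δ₁ +E Δ₂ , k₁ + k₂ + cost c black , k₃ + k₄ , _ , _ ,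
    app D₁ D₂ (≈E-refl _) ,
    subst (Δ₁ +E Δ₂ ⊢[ k₃ + k₄ ]⟨ _ ⟩ s ∶M_) (sym (at-+E j Γ₁ Γ₂)) (DerM-++ Ds₁ Ds₂) ,
    (e ▸ +E-cong e₁ e₂ ▸ ≈E-sym (subE-+E j Γ₁ Γ₂ Δ₁ Δ₂)) ,
    +-app-shuffle k₁ k₂ k₃ k₄ (cost c black)

  DerM-sub⁻¹ : ∀ j s t {Θ k n M} → Θ ⊢[ k ]⟨ n ⟩ sub j s t ∶M M →
    Σ[ Γ ∈ Env ] Σ[ Δ ∈ Env ] Σ[ k₁ ∈ ℕ ] Σ[ k₂ ∈ ℕ ] Σ[ n₁ ∈ ℕ ] Σ[ n₂ ∈ ℕ ]
      (Γ ⊢[ k₁ ]⟨ n₁ ⟩ t ∶M M × Δ ⊢[ k₂ ]⟨ n₂ ⟩ s ∶M at j Γ × Θ ≈E subE j Γ Δ × k ≡ k₁ + k₂)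
  DerM-sub⁻¹ j s t (nil e) =
    [] , [] , 0 , 0 , 0 , 0 , nil [] , subst ([] ⊢[ 0 ]⟨ 0 ⟩ s ∶M_) (sym (at-[] j)) (nil []) ,
    (e ▸ ≈E-sym (subE-[] j)) , refl
  DerM-sub⁻¹ j s t (cons D Ds e) with Der-sub⁻¹ j s t D | DerM-sub⁻¹ j s t Ds
  ... | Γ₁ , Δ₁ , k₁ , k₃ , _ , _ , D₁ , Ds₁ , e₁ , refl | Γ₂ , Δ₂ , k₂ , k₄ , _ , _ , D₂ , Ds₂ , e₂ , refl =
    Γ₁ +E Γ₂ , Δ₁ +E Δ₂ , k₁ + k₂ , k₃ + k₄ , _ , _ ,
    cons D₁ D₂ (≈E-refl _) ,
    subst (Δ₁ +E Δ₂ ⊢[ k₃ + k₄ ]⟨ _ ⟩ s ∶M_) (sym (at-+E j Γ₁ Γ₂)) (DerM-++ Ds₁ Ds₂) ,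
    (e ▸ +E-cong e₁ e₂ ▸ ≈E-sym (subE-+E j Γ₁ Γ₂ Δ₁ Δ₂)) ,
    interchange k₁ k₃ k₂ k₄



-- Subject reduction and expansion, head normal forms

Der-β : ∀ {t u Θ k n L} → Θ ⊢[ k ]⟨ n ⟩ app (lam t) u ∶ L → Σ[ m ∈ ℕ ] (m < n × Θ ⊢[ k ]⟨ m ⟩ sub 0 u t ∶ L)
Der-β {t} {u} (app {k₁ = k₁} {k₂ = k₂} (lam D) Ds e) with Der-sub 0 u t D Ds
... | m , m≤ , D' = m , s≤s (m≤n⇒m≤1+n m≤) , reindex (sym (+-identityʳ (k₁ + k₂))) refl (Der-≈E D' (≈E-sym e))

mutual
  subject-reduction : ∀ {t t' Θ k n L} → t ⟶β t' → Θ ⊢[ k ]⟨ n ⟩ t ∶ L →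
    Σ[ m ∈ ℕ ] (m ≤ n × Θ ⊢[ k ]⟨ m ⟩ t' ∶ L)
  subject-reduction beta D with Der-β D
  ... | m , m< , D' = m , <⇒≤ m< , D'
  subject-reduction (ξlam r) (lam D) with subject-reduction r D
  ... | m , m≤ , D' = suc m , s≤s m≤ , lam D'
  subject-reduction (ξappl r) (app D Ds e) with subject-reduction r D
  ... | m , m≤ , D' = _ , s≤s (+-mono-≤ m≤ ≤-refl) , app D' Ds e
  subject-reduction (ξappr r) (app D Ds e) with subject-reductionM r Ds
  ... | m , m≤ , Ds' = _ , s≤s (+-mono-≤ (≤-refl {_}) m≤) , app D Ds' e

  subject-reductionM : ∀ {t t' Θ k n M} → t ⟶β t' → Θ ⊢[ k ]⟨ n ⟩ t ∶M M →
    Σ[ m ∈ ℕ ] (m ≤ n × Θ ⊢[ k ]⟨ m ⟩ t' ∶M M)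
  subject-reductionM r (nil e) = 0 , z≤n , nil e
  subject-reductionM r (cons D Ds e) with subject-reduction r D | subject-reductionM r Ds
  ... | m₁ , m₁≤ , D' | m₂ , m₂≤ , Ds' = m₁ + m₂ , +-mono-≤ m₁≤ m₂≤ , cons D' Ds' e

subject-reduction* : ∀ {t t' Θ k n L} → t ↠β t' → Θ ⊢[ k ]⟨ n ⟩ t ∶ L →
  Σ[ m ∈ ℕ ] (m ≤ n × Θ ⊢[ k ]⟨ m ⟩ t' ∶ L)
subject-reduction* ε D = _ , ≤-refl , D
subject-reduction* (r ◅ rs) D with subject-reduction r D
... | m₁ , m₁≤ , D₁ with subject-reduction* rs D₁
...   | m₂ , m₂≤ , D₂ = m₂ , ≤-trans m₂≤ m₁≤ , D₂

mutual
  subject-expansion : ∀ {t t' Θ k n L} → t ⟶β t' → Θ ⊢[ k ]⟨ n ⟩ t' ∶ L → Σ[ m ∈ ℕ ] Θ ⊢[ k ]⟨ m ⟩ t ∶ L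
  subject-expansion (beta {t} {u}) D with Der-sub⁻¹ 0 u t D
  ... | Γ , Δ , k₁ , k₂ , _ , _ , D' , Ds , e , refl =
    _ , reindex (+-identityʳ (k₁ + k₂)) refl (app (lam (Der-≈E D' (≈E-hd∷tl Γ))) Ds e)
  subject-expansion (ξlam r) (lam D) with subject-expansion r D
  ... | _ , D' = _ , lam D'
  subject-expansion (ξappl r) (app D Ds e) with subject-expansion r D
  ... | _ , D' = _ , app D' Ds e
  subject-expansion (ξappr r) (app D Ds e) with subject-expansionM r Ds
  ... | _ , Ds' = _ , app D Ds' e

  subject-expansionM : ∀ {t t' Θ k n M} → t ⟶β t' → Θ ⊢[ k ]⟨ n ⟩ t' ∶M M → Σ[ m ∈ ℕ ] Θ ⊢[ k ]⟨ m ⟩ t ∶M M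
  subject-expansionM r (nil e) = 0 , nil e
  subject-expansionM r (cons D Ds e) with subject-expansion r D | subject-expansionM r Ds
  ... | _ , D' | _ , Ds' = _ , cons D' Ds' e

subject-expansion* : ∀ {t t' Θ k n L} → t ↠β t' → Θ ⊢[ k ]⟨ n ⟩ t' ∶ L → Σ[ m ∈ ℕ ] Θ ⊢[ k ]⟨ m ⟩ t ∶ L
subject-expansion* ε D = _ , D
subject-expansion* (r ◅ rs) D with subject-expansion* rs D
... | _ , D' = subject-expansion r D'

data _⟶h_ : Term → Term → Set where
  beta  : ∀ {t u} → app (lam t) u ⟶h sub 0 u t
  ξlam  : ∀ {t t'} → t ⟶h t' → lam t ⟶h lam t'
  ξappl : ∀ {t t' u} → t ⟶h t' → app t u ⟶h app t' u

⟶h⇒⟶β : ∀ {t t'} → t ⟶h t' → t ⟶β t'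
⟶h⇒⟶β beta      = beta
⟶h⇒⟶β (ξlam r)  = ξlam (⟶h⇒⟶β r)
⟶h⇒⟶β (ξappl r) = ξappl (⟶h⇒⟶β r)

head-reduction-shrinks : ∀ {t t' Θ k n L} → t ⟶h t' → Θ ⊢[ k ]⟨ n ⟩ t ∶ L →
  Σ[ m ∈ ℕ ] (m < n × Θ ⊢[ k ]⟨ m ⟩ t' ∶ L)
head-reduction-shrinks beta D = Der-β D
head-reduction-shrinks (ξlam r) (lam D) with head-reduction-shrinks r D
... | m , m< , D' = suc m , s≤s m< , lam D'
head-reduction-shrinks (ξappl r) (app {n₂ = n₂} D Ds e) with head-reduction-shrinks r D
... | m , m< , D' = _ , s≤s (+-monoˡ-< n₂ m<) , app D' Ds e

data HeadView : Term → Set where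
  hnf : ∀ m y ts → HeadView (lams m (apps (var y) ts))
  red : ∀ {t t'} → t ⟶h t' → HeadView t

apps-∷ʳ : ∀ h ts u → apps h (ts ++ u ∷ []) ≡ app (apps h ts) u
apps-∷ʳ h []       u = refl
apps-∷ʳ h (t ∷ ts) u = apps-∷ʳ (app h t) ts u

headView : ∀ t → HeadView t
headView (var x) = hnf 0 x []
headView (lam t) with headView t
... | hnf m y ts = hnf (suc m) y ts
... | red r      = red (ξlam r)
headView (app t u) with headView t
... | hnf zero    y ts = subst HeadView (apps-∷ʳ (var y) ts u) (hnf 0 y (ts ++ u ∷ []))
... | hnf (suc m) y ts = red beta
... | red r            = red (ξappl r)

Der⇒HasHNF : ∀ N t {Γ k n L} → Γ ⊢[ k ]⟨ n ⟩ t ∶ L → n < N → HasHNF t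
Der⇒HasHNF (suc N) t D n<N with headView t
... | hnf m y ts = m , y , ts , ε
... | red {t' = t'} r with head-reduction-shrinks r D
...   | m , m<n , D' with Der⇒HasHNF N t' D' (<-≤-trans m<n (s≤s⁻¹ n<N))
...     | m′ , y , ts , rs = m′ , y , ts , ⟶h⇒⟶β r ◅ rs



-- Abstractions and spines

-- Rs lists the binders' multisets innermost first, as they occur in the environment of the body.
arrows : List MTy → LTy → LTy
arrows []       L = L
arrows (R ∷ Rs) L = arrows Rs (arr R black L)

arrows-++ : ∀ Rs Ss L → arrows (Rs ++ Ss) L ≡ arrows Ss (arrows Rs L)
arrows-++ []       Ss L = refl
arrows-++ (R ∷ Rs) Ss L = arrows-++ Rs Ss (arr R black L)

lams-+ : ∀ m n b → lams (m + n) b ≡ lams m (lams n b)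
lams-+ zero    n b = refl
lams-+ (suc m) n b = cong lam (lams-+ m n b)

lams-lam : ∀ m b → lams m (lam b) ≡ lam (lams m b)
lams-lam zero    b = refl
lams-lam (suc m) b = cong lam (lams-lam m b)

length-∷ʳ : ∀ {A : Set} (xs : List A) x → length (xs ++ x ∷ []) ≡ suc (length xs)
length-∷ʳ xs x = trans (length-++ xs) (+-comm (length xs) 1)

Der-lams⁻¹ : ∀ m b {Γ k n L} → Γ ⊢[ k ]⟨ n ⟩ lams m b ∶ L →
  Σ[ Rs ∈ List MTy ] Σ[ L₀ ∈ LTy ] Σ[ n₀ ∈ ℕ ]
    (length Rs ≡ m × L ≡ arrows Rs L₀ × Rs ++ Γ ⊢[ k ]⟨ n₀ ⟩ b ∶ L₀ × n ≡ m + n₀)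
Der-lams⁻¹ zero    b {L = L} D = [] , L , _ , refl , refl , D , refl
Der-lams⁻¹ (suc m) b (lam {Γ = Γ} {M = M} D) with Der-lams⁻¹ m b D
... | Rs , L₀ , n₀ , refl , refl , D' , refl =
  Rs ++ M ∷ [] , L₀ , n₀ , length-∷ʳ Rs M , sym (arrows-++ Rs (M ∷ []) L₀) ,
  subst (λ Δ → Δ ⊢[ _ ]⟨ n₀ ⟩ b ∶ L₀) (sym (++-assoc Rs (M ∷ []) Γ)) D' , refl

Der-lams : ∀ Rs {Γ k n b L₀} → Rs ++ Γ ⊢[ k ]⟨ n ⟩ b ∶ L₀ →
  Σ[ m ∈ ℕ ] Γ ⊢[ k ]⟨ m ⟩ lams (length Rs) b ∶ arrows Rs L₀
Der-lams []       D = _ , D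
Der-lams (R ∷ Rs) {b = b} D with Der-lams Rs (lam D)
... | m , D' = m , subst (λ t → _ ⊢[ _ ]⟨ m ⟩ t ∶ _) (lams-lam (length Rs) b) D'

-- Spine P A as L₀ Θ k: applying a head of type A to the arguments as gives type L₀.
data Spine (P : ℕ → Set) : LTy → List Term → LTy → Env → ℕ → Set where
  nil  : ∀ {L} → Spine P L [] L [] 0
  cons : ∀ {Θ₁ Θ₂ k₁ k₂ n₁ a as M c A L₀} →
         Θ₁ ⊢[ k₁ ]⟨ n₁ ⟩ a ∶M M → P n₁ → Spine P A as L₀ Θ₂ k₂ →
         Spine P (arr M c A) (a ∷ as) L₀ (Θ₁ +E Θ₂) (k₁ + cost c black + k₂)

Spine-map : ∀ {P Q A as L₀ Θ k} → (∀ {n} → P n → Q n) → Spine P A as L₀ Θ k → Spine Q A as L₀ Θ k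
Spine-map f nil              = nil
Spine-map f (cons Ds p rest) = cons Ds (f p) (Spine-map f rest)

Spine-++⁻¹ : ∀ {P} ts {ex A L₀ Θ k} → Spine P A (ts ++ ex) L₀ Θ k →
  Σ[ B ∈ LTy ] Σ[ Θ₁ ∈ Env ] Σ[ Θ₂ ∈ Env ] Σ[ k₁ ∈ ℕ ] Σ[ k₂ ∈ ℕ ]
    (Spine P A ts B Θ₁ k₁ × Spine P B ex L₀ Θ₂ k₂ × Θ ≈E (Θ₁ +E Θ₂) × k ≡ k₁ + k₂)
Spine-++⁻¹ []       {A = A} {Θ = Θ} sp = A , [] , Θ , 0 , _ , nil , sp , ≈E-refl Θ , refl
Spine-++⁻¹ (t ∷ ts) (cons {Θ₁ = Θa} {k₁ = ka} {c = c} Ds p rest) with Spine-++⁻¹ ts rest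
... | B , Θ₁ , Θ₂ , k₁ , k₂ , sp₁ , sp₂ , e , refl =
  B , Θa +E Θ₁ , Θ₂ , ka + cost c black + k₁ , k₂ , cons Ds p sp₁ , sp₂ ,
  (+E-congʳ Θa e ▸ ≡⇒≈E (sym (+E-assoc Θa Θ₁ Θ₂))) , sym (+-assoc (ka + cost c black) k₁ k₂)

+-assoc₄ : ∀ a b c d → a + b + c + d ≡ a + (b + c + d)
+-assoc₄ = solve-∀

Der-apps⁻¹ : ∀ h as {Θ k n L₀} → Θ ⊢[ k ]⟨ n ⟩ apps h as ∶ L₀ →
  Σ[ Θh ∈ Env ] Σ[ kh ∈ ℕ ] Σ[ nh ∈ ℕ ] Σ[ A ∈ LTy ] Σ[ Θa ∈ Env ] Σ[ ka ∈ ℕ ]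
    (Θh ⊢[ kh ]⟨ nh ⟩ h ∶ A × Spine (_< n) A as L₀ Θa ka × Θ ≈E (Θh +E Θa) × k ≡ kh + ka × nh ≤ n)
Der-apps⁻¹ h []       {Θ} {k} D = Θ , k , _ , _ , [] , 0 , D , nil , ≡⇒≈E (sym (+E-identityʳ Θ)) , sym (+-identityʳ k) , ≤-refl
Der-apps⁻¹ h (a ∷ as) D with Der-apps⁻¹ (app h a) as D
... | _ , _ , _ , _ , Θa , ka , app {Γ₁ = Θ₁} {Γ₂ = Θ₂} {k₁ = k₁} {k₂ = k₂} {n₁ = n₁} {n₂ = n₂} {c = c} Dh Ds e , sp , e' , refl , n≤ =
  Θ₁ , k₁ , n₁ , _ , Θ₂ +E Θa , k₂ + cost c black + ka , Dh ,
  cons Ds (≤-trans (s≤s (m≤n+m n₂ n₁)) n≤) sp ,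
  (e' ▸ +E-congˡ Θa e ▸ ≡⇒≈E (+E-assoc Θ₁ Θ₂ Θa)) ,
  +-assoc₄ k₁ k₂ (cost c black) ka ,
  ≤-trans (≤-trans (m≤m+n n₁ n₂) (n≤1+n _)) n≤

Der-apps : ∀ {P h as Θh kh nh A Θa ka L₀} → Θh ⊢[ kh ]⟨ nh ⟩ h ∶ A → Spine P A as L₀ Θa ka →
  Σ[ n ∈ ℕ ] Θh +E Θa ⊢[ kh + ka ]⟨ n ⟩ apps h as ∶ L₀
Der-apps {Θh = Θh} {kh} D nil = _ , reindex (sym (+-identityʳ kh)) refl (Der-≈E D (≡⇒≈E (sym (+E-identityʳ Θh))))
Der-apps {Θh = Θh} {kh} D (cons {Θ₁ = Θ₁} {Θ₂ = Θ₂} {k₁ = k₁} {k₂ = k₂} {c = c} Ds _ rest)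
  with Der-apps (app D Ds (≈E-refl _)) rest
... | n , D' = n , reindex (+-assoc₄ kh k₁ (cost c black) k₂) refl (Der-≈E D' (≡⇒≈E (+E-assoc Θh Θ₁ Θ₂)))

arrows-mono : ∀ {q k Rs' Rs X' X} → WhMs neg q Rs' Rs → Wh pos k X' X → Wh pos (q + k) (arrows Rs' X') (arrows Rs X)
arrows-mono [] w = w
arrows-mono {k = k} (_∷_ {k₁ = q₁} {k₂ = q₂} m ms) w =
  Wh-≡ (e q₁ q₂ k) (arrows-mono ms (same m w))
  where
  e : ∀ a b c → b + (a + c) ≡ a + b + c
  e = solve-∀

Wh-arr-black : ∀ c {q k M' M X' X} → WhM neg q M' M → Wh pos k X' X →
  Wh pos (q + k + cost c black) (arr M' c X') (arr M black X)
Wh-arr-black white m w = whiten m w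
Wh-arr-black black m w = Wh-≡ (sym (+-identityʳ _)) (same m w)



-- Simulation

Whitened : Term → Env → ℕ → LTy → Set
Whitened u Γ k L = Σ[ Γ' ∈ Env ] Σ[ L' ∈ LTy ] Σ[ k' ∈ ℕ ] Σ[ p ∈ ℕ ] Σ[ n' ∈ ℕ ]
  (Γ' ⊢[ k' ]⟨ n' ⟩ u ∶ L' × WhP pos p Γ' L' Γ L × k ≡ k' + p)

WhitenedM : Term → Env → ℕ → MTy → Set
WhitenedM u Θ k M = Σ[ Θ' ∈ Env ] Σ[ M' ∈ MTy ] Σ[ k' ∈ ℕ ] Σ[ q₁ ∈ ℕ ] Σ[ q₂ ∈ ℕ ] Σ[ n' ∈ ℕ ]
  (Θ' ⊢[ k' ]⟨ n' ⟩ u ∶M M' × WhE neg q₁ Θ' Θ × WhM pos q₂ M' M × k ≡ k' + (q₁ + q₂))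

-- WhitenedBody p b Δ k L₀: b whitens a derivation Δ ⊢ᵏ _ : L₀ of the body of a head normal form
-- under p further abstractions. Rs types their variables, and B whitens the type arrows Ms L₀ of
-- those abstractions for any binder types Ms whitened by Rs, at the extra cost w.
WhitenedBody : ℕ → Term → Env → ℕ → LTy → Set
WhitenedBody p b Δ k L₀ = Σ[ Rs ∈ List MTy ] Σ[ Θ ∈ Env ] Σ[ B ∈ LTy ] Σ[ k' ∈ ℕ ] Σ[ q ∈ ℕ ] Σ[ w ∈ ℕ ] Σ[ n' ∈ ℕ ]
  (length Rs ≡ p × Θ ⊢[ k' ]⟨ n' ⟩ b ∶ B × WhE neg q (Rs ++ Θ) Δ ×
   (∀ {Ms q'} → WhMs neg q' Rs Ms → Wh pos (q' + w) B (arrows Ms L₀)) × k ≡ k' + (q + w))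

WhitenedBody⇒Whitened : ∀ n₀ p Rs₁ Rs₂ {b Γ k L₀} → length Rs₁ ≡ n₀ → length Rs₂ ≡ p →
  WhitenedBody p b (Rs₂ ++ Rs₁ ++ Γ) k L₀ → Whitened (lams n₀ b) Γ k (arrows Rs₁ (arrows Rs₂ L₀))
WhitenedBody⇒Whitened n₀ p Rs₁ Rs₂ {b} len₁ len₂ (Rs , Θ , B , k' , q , w , _ , lenR , Db , W , f , refl)
  with Der-lams (takeE n₀ Θ) (Der-≈E Db (takeE++dropE n₀ Θ))
... | m , Dl
  with WhE-++⁻¹ Rs Rs₂ (trans lenR (sym len₂)) (WhE-≈ˡ (++-congʳ-≈E Rs (≈E-sym (takeE++dropE n₀ Θ))) W)
... | q₂ , _ , ws₂ , W' , refl
  with WhE-++⁻¹ (takeE n₀ Θ) Rs₁ (trans (length-takeE n₀ Θ) (sym len₁)) W'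
... | q₁ , q₀ , ws₁ , W₀ , refl =
  dropE n₀ Θ , arrows (takeE n₀ Θ) B , k' , q₀ + (q₁ + (q₂ + w)) , m ,
  subst (λ i → dropE n₀ Θ ⊢[ k' ]⟨ m ⟩ lams i b ∶ arrows (takeE n₀ Θ) B) (length-takeE n₀ Θ) Dl ,
  (q₀ , q₁ + (q₂ + w) , refl , W₀ , arrows-mono ws₁ (f ws₂)) ,
  cong (k' +_) (e q₂ q₁ q₀ w)
  where
  e : ∀ a b c d → a + (b + c) + d ≡ c + (b + (a + d))
  e = solve-∀

module Simulation {R : Term → Term → Set} (bis : IsBSim R) where

  mutual
    simulation : ∀ N {t u Γ k n L} → R t u → Γ ⊢[ k ]⟨ n ⟩ t ∶ L → n < N → Whitened u Γ k L
    simulation (suc N) {t} r D n<N with bis r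
    ... | inj₁ noHNF = ⊥-elim (noHNF (Der⇒HasHNF (suc N) t D n<N))
    ... | inj₂ (n₀ , p , y , ts , ex , us , t↠ , u↠ , ts~us , ex~η) with subject-reduction* t↠ D
    ...   | m , m≤n , D' with simulationHNF N n₀ p y ts ex us ts~us ex~η
                                (subst (λ s → _ ⊢[ _ ]⟨ m ⟩ s ∶ _) (lams-+ n₀ p _) D') (≤-trans m≤n (s≤s⁻¹ n<N))
    ...     | Γ' , L' , k' , q , _ , Du , wh , k≡ with subject-expansion* u↠ Du
    ...       | n' , Du' = Γ' , L' , k' , q , n' , Du' , wh , k≡

    simulationM : ∀ N {t u Θ k n M} → R t u → Θ ⊢[ k ]⟨ n ⟩ t ∶M M → n < N → WhitenedM u Θ k M
    simulationM N r (nil e) _ = [] , [] , 0 , 0 , 0 , 0 , nil [] , WhE-≈ʳ [] (≈E-sym e) , [] , refl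
    simulationM N r (cons {n₁ = n₁} {n₂ = n₂} D Ds e) n<N
      with simulation N r D (≤-<-trans (m≤m+n n₁ n₂) n<N) | simulationM N r Ds (≤-<-trans (m≤n+m n₂ n₁) n<N)
    ... | Γ' , L' , k₁ , _ , _ , D' , (x₁ , x₂ , refl , wE₁ , wL) , refl
        | Θ' , M' , k₂ , q₁ , q₂ , _ , Ds' , wE₂ , wM , refl =
      Γ' +E Θ' , L' ∷ M' , k₁ + k₂ , x₁ + q₁ , x₂ + q₂ , _ , cons D' Ds' (≈E-refl _) ,
      WhE-≈ʳ (WhE-+E wE₁ wE₂) (≈E-sym e) , ins {M₁ = []} wL wM ,
      trans (interchange k₁ (x₁ + x₂) k₂ (q₁ + q₂)) (cong (k₁ + k₂ +_) (interchange x₁ x₂ q₁ q₂))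

    simulationHNF : ∀ N n₀ p y ts ex us → Pointwise R ts (map (lift p 0) us) → Pointwise R ex (etaVars p) →
      ∀ {Γ k n L} → Γ ⊢[ k ]⟨ n ⟩ lams n₀ (lams p (apps (var (y + p)) (ts ++ ex))) ∶ L → n ≤ N →
      Whitened (lams n₀ (apps (var y) us)) Γ k L
    simulationHNF N n₀ p y ts ex us ts~us ex~η D n≤N with Der-lams⁻¹ n₀ _ D
    ... | Rs₁ , _ , _ , len₁ , refl , D₁ , refl with Der-lams⁻¹ p _ D₁
    ...   | Rs₂ , _ , nb , len₂ , refl , D₂ , refl =
      WhitenedBody⇒Whitened n₀ p Rs₁ Rs₂ len₁ len₂
        (simulateBody N p y ts ex us ts~us ex~η D₂ (≤-trans (m≤n+m nb (n₀ + p)) (subst (_≤ N) (sym (+-assoc n₀ p nb)) n≤N)))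

    simulateBody : ∀ N p y ts ex us → Pointwise R ts (map (lift p 0) us) → Pointwise R ex (etaVars p) →
      ∀ {Δ k n L₀} → Δ ⊢[ k ]⟨ n ⟩ apps (var (y + p)) (ts ++ ex) ∶ L₀ → n ≤ N →
      WhitenedBody p (apps (var y) us) Δ k L₀
    simulateBody N p y ts ex us ts~us ex~η {Δ} D n≤N
      with Der-apps⁻¹ (var (y + p)) (ts ++ ex) D
    ... | Θh , _ , _ , Ah , _ , _ , ax eh , sp , eb , refl , _
      with Spine-++⁻¹ ts (Spine-map (λ m<n → <-≤-trans m<n n≤N) sp)
    ... | _ , Θ₁ , Θ₂ , k₁ , _ , sp₁ , sp₂ , ea , refl
      with simulateEta N p ex~η sp₂
    ... | B , Rs , qe₁ , qe₂ , w , lenR , wB , wEη , f , refl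
      with simulateArgs N p us ts~us sp₁ wB
    ... | A , Θ , k' , qt₁ , qt₂ , spu , wEts , wA , k≡
      with Der-apps (ax {x = y} {L = A} (≈E-refl _)) spu
    ... | n' , Du =
      Rs , single y A +E Θ , B , 0 + k' , qt₂ + (qt₁ + qe₂) , w , n' , lenR , Du , W , f , cost-eq
      where
      W : WhE neg (qt₂ + (qt₁ + qe₂)) (Rs ++ (single y A +E Θ)) Δ
      W = WhE-≈ˡ (≈E-sym (single-+E-shiftE p y A Θ Rs lenR))
            (WhE-≈ʳ (WhE-+E (WhE-≈ʳ (WhE-single (p + y) wA) (≈E-sym (subst (λ z → Θh ≈E single z Ah) (+-comm y p) eh)))
                            (WhE-+E wEts wEη))
                    (≈E-sym (eb ▸ +E-congʳ Θh ea)))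
      open ≡-Reasoning
      cost-eq : 0 + (k₁ + (qe₁ + qe₂ + w)) ≡ 0 + k' + (qt₂ + (qt₁ + qe₂) + w)
      cost-eq = begin
        0 + (k₁ + (qe₁ + qe₂ + w))       ≡⟨ e₁ k₁ qe₁ qe₂ w ⟩
        k₁ + qe₁ + (qe₂ + w)             ≡⟨ cong (_+ (qe₂ + w)) k≡ ⟩
        k' + (qt₁ + qt₂) + (qe₂ + w)     ≡⟨ e₂ k' qt₁ qt₂ qe₂ w ⟩
        0 + k' + (qt₂ + (qt₁ + qe₂) + w) ∎
        where
        e₁ : ∀ k a b w → 0 + (k + (a + b + w)) ≡ k + a + (b + w)
        e₁ = solve-∀
        e₂ : ∀ k a b c w → k + (a + b) + (c + w) ≡ 0 + k + (b + (a + c) + w)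
        e₂ = solve-∀

    simulateArgs : ∀ N p us {ts A B Θ k} → Pointwise R ts (map (lift p 0) us) → Spine (_< N) A ts B Θ k →
      ∀ {B' qb} → Wh neg qb B' B →
      Σ[ A' ∈ LTy ] Σ[ Θ' ∈ Env ] Σ[ k' ∈ ℕ ] Σ[ q₁ ∈ ℕ ] Σ[ q₂ ∈ ℕ ]
        (Spine (λ _ → ⊤) A' us B' Θ' k' × WhE neg q₁ (shiftE p Θ') Θ × Wh neg q₂ A' A × k + qb ≡ k' + (q₁ + q₂))
    simulateArgs N p [] [] nil {B'} {qb} wB = B' , [] , 0 , 0 , qb , nil , WhE-≈ˡ (shiftE-[] p) [] , wB , refl
    simulateArgs N p (u ∷ us) (r ∷ rs) (cons {k₂ = k₂} {c = c} Ds n<N rest) {qb = qb} wB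
      with simulationM N r Ds n<N | simulateArgs N p us rs rest wB
    ... | _ , M' , k₁ , a , b , _ , Ds' , wE , wM , refl | A' , Θ' , k' , q₁ , q₂ , sp , wE' , wA , k≡
      with DerM-lift⁻¹ 0 p u Ds'
    ...   | Θ , e , Ds″ =
      arr M' c A' , Θ +E Θ' , k₁ + cost c black + k' , a + q₁ , b + q₂ ,
      cons Ds″ tt sp ,
      WhE-≈ˡ (shiftE-+E p Θ Θ') (WhE-+E (WhE-≈ˡ (≈E-sym e) wE) wE') ,
      same wM wA ,
      cost-eq
      where
      open ≡-Reasoning
      cost-eq : k₁ + (a + b) + cost c black + k₂ + qb ≡ k₁ + cost c black + k' + (a + q₁ + (b + q₂))
      cost-eq = begin
        k₁ + (a + b) + cost c black + k₂ + qb         ≡⟨ e₁ k₁ a b (cost c black) k₂ qb ⟩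
        k₁ + cost c black + (a + b) + (k₂ + qb)       ≡⟨ cong (k₁ + cost c black + (a + b) +_) k≡ ⟩
        k₁ + cost c black + (a + b) + (k' + (q₁ + q₂)) ≡⟨ e₂ (k₁ + cost c black) a b k' q₁ q₂ ⟩
        k₁ + cost c black + k' + (a + q₁ + (b + q₂))   ∎
        where
        e₁ : ∀ k a b c d e → k + (a + b) + c + d + e ≡ k + c + (a + b) + (d + e)
        e₁ = solve-∀
        e₂ : ∀ k a b d q r → k + (a + b) + (d + (q + r)) ≡ k + d + (a + q + (b + r))
        e₂ = solve-∀

    simulateEta : ∀ N p {ex B L₀ Θ k} → Pointwise R ex (etaVars p) → Spine (_< N) B ex L₀ Θ k →
      Σ[ B' ∈ LTy ] Σ[ Rs ∈ List MTy ] Σ[ q₁ ∈ ℕ ] Σ[ q₂ ∈ ℕ ] Σ[ w ∈ ℕ ]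
        (length Rs ≡ p × Wh neg q₁ B' B × WhE neg q₂ Rs Θ ×
         (∀ {Ms q} → WhMs neg q Rs Ms → Wh pos (q + w) B' (arrows Ms L₀)) × k ≡ q₁ + q₂ + w)
    simulateEta N zero {L₀ = L₀} [] nil = L₀ , [] , 0 , 0 , 0 , refl , Wh-refl L₀ , [] , f , refl
      where
      f : ∀ {Ms q} → WhMs neg q [] Ms → Wh pos (q + 0) L₀ (arrows Ms L₀)
      f w with WhMs-[]⁻¹ w
      ... | refl , refl = Wh-refl L₀
    simulateEta N (suc p) {L₀ = L₀} (r ∷ rs) (cons {c = c} Ds n<N rest)
      with simulationM N r Ds n<N | simulateEta N p rs rest
    ... | _ , M' , _ , a , b , _ , Ds' , wE , wM , refl | B' , Rs , q₁ , q₂ , w , len , wB , wE' , f , refl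
      with DerM-var⁻¹ Ds'
    ...   | refl , e =
      arr M' c B' , Rs ++ M' ∷ [] , b + q₁ , a + q₂ , cost c black + w ,
      trans (length-∷ʳ Rs M') (cong suc len) , same wM wB ,
      WhE-≈ˡ (≈E-sym (singleM-+E-∷ʳ p M' Rs len)) (WhE-+E (WhE-≈ˡ (≈E-sym e) wE) wE') ,
      f′ , e₁ a b q₁ q₂ w (cost c black)
      where
      e₁ : ∀ a b q₁ q₂ w c → 0 + (a + b) + c + (q₁ + q₂ + w) ≡ b + q₁ + (a + q₂) + (c + w)
      e₁ = solve-∀
      f′ : ∀ {Ms q} → WhMs neg q (Rs ++ M' ∷ []) Ms → Wh pos (q + (cost c black + w)) (arr M' c B') (arrows Ms L₀)
      f′ ws with WhMs-++⁻¹ Rs (M' ∷ []) ws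
      ... | Ms , _ , q , q′ , refl , ws₁ , ws₂ , refl with WhMs-[-]⁻¹ ws₂
      ...   | M₀ , refl , m₀ =
        subst (Wh pos _ _) (sym (arrows-++ Ms (M₀ ∷ []) L₀))
          (Wh-≡ (e₂ q q′ w (cost c black)) (Wh-arr-black c m₀ (f ws₁)))
        where
        e₂ : ∀ q q′ w c → q′ + (q + w) + c ≡ q + q′ + (c + w)
        e₂ = solve-∀

lemma4 : (t u : Term) → t ⊑Bη u →
         (Γ : Env) (k : ℕ) (L : LTy) → Γ ⊢[ k ] paint t ∶ L →
         Σ[ Γ' ∈ Env ] Σ[ L' ∈ LTy ] Σ[ k' ∈ ℕ ] Σ[ p ∈ ℕ ]
           (Γ' ⊢[ k' ] paint u ∶ L' × WhP pos p Γ' L' Γ L × k ≡ k' + p)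
lemma4 t u (R , bis , r) Γ k L D with ⊢⇒Der t D
... | n , D' with Simulation.simulation bis (suc n) r D' ≤-refl
...   | Γ' , L' , k' , p , _ , Du , wh , k≡ = Γ' , L' , k' , p , Der⇒⊢ Du , wh , k≡
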